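{- For any two integers $q,h>0$ and all sufficiently large $n$, there exist an unweighted undirected $n$-node graph $G=(V,E)$ and a pair $s,t\in V$ such that every $2hq$-FT $(2q-1)$-additive spanner for $G$ for the single pair $(s,t)$ has $\Omega\left(\left(\frac{n}{hq}\right)^{2-2/(h+1)}\right)$ edges.
   Context: For a graph $G=(V,E)$ and $P\subseteq V\times V$, a subgraph $H\subseteq G$ is an $f$-FT $\beta$-additive $P$-pairwise spanner if $\mathrm{dist}_{H\setminus F}(s,t)\leq \mathrm{dist}_{G\setminus F}(s,t)+\beta$ for all $(s,t)\in P$ and all $F\subseteq E$ with $|F|\leq f$. A spanner for the single pair $(s,t)$ means $P=\{(s,t)\}$. -}

module Defs where

open import Data.Nat using (ℕ; zero; suc; _+_; _≤_; _<ᵇ_)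
open import Data.Fin using (Fin; toℕ; _≟_)
open import Data.Bool using (Bool; true; false; _∧_; _∨_; not)
open import Data.Bool.ListAction using (any)
open import Data.List using (List; length; filterᵇ; cartesianProduct; allFin)
open import Data.List.Relation.Unary.All using (All)
open import Data.Product using (Σ; _×_; _,_; proj₁; proj₂)
open import Relation.Nullary.Decidable using (⌊_⌋)
open import Relation.Binary.PropositionalEquality using (_≡_)

record Graph (n : ℕ) : Set where
  field
    adj    : Fin n → Fin n → Bool
    adj-sym    : ∀ u v → adj u v ≡ adj v u
    adj-irrefl : ∀ u → adj u u ≡ false
open Graph public

_⊆G_ : ∀ {n} → Graph n → Graph n → Set
H ⊆G G = ∀ u v → adj H u v ≡ true → adj G u v ≡ true

numEdges : ∀ {n} → Graph n → ℕ
numEdges {n} H =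
  length (filterᵇ (λ p → (toℕ (proj₁ p) <ᵇ toℕ (proj₂ p)) ∧ adj H (proj₁ p) (proj₂ p))
                  (cartesianProduct (allFin n) (allFin n)))

FaultSet : ℕ → Set
FaultSet n = List (Fin n × Fin n)

ValidFaults : ∀ {n} → ℕ → Graph n → FaultSet n → Set
ValidFaults f G F = (length F ≤ f) × All (λ e → adj G (proj₁ e) (proj₂ e) ≡ true) F

inF : ∀ {n} → FaultSet n → Fin n → Fin n → Bool
inF F u v = any (λ e → (⌊ proj₁ e ≟ u ⌋ ∧ ⌊ proj₂ e ≟ v ⌋) ∨ (⌊ proj₁ e ≟ v ⌋ ∧ ⌊ proj₂ e ≟ u ⌋)) F

adjMinus : ∀ {n} → Graph n → FaultSet n → Fin n → Fin n → Bool
adjMinus G F u v = adj G u v ∧ not (inF F u v)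

data Walk {n : ℕ} (A : Fin n → Fin n → Bool) : Fin n → Fin n → ℕ → Set where
  here : ∀ {u} → Walk A u u 0
  step : ∀ {u v w k} → A u v ≡ true → Walk A v w k → Walk A u w (suc k)

-- dist_A(s,t) ≤ k   (false for every k when t is unreachable, i.e. dist = ∞)
DistLE : ∀ {n} → (Fin n → Fin n → Bool) → Fin n → Fin n → ℕ → Set
DistLE A s t k = Σ ℕ (λ k' → (k' ≤ k) × Walk A s t k')

-- H is an f-FT β-additive spanner of G for the single pair (s,t):
-- H ⊆ G and for every F ⊆ E(G) with |F| ≤ f,
--   dist_{H∖F}(s,t) ≤ dist_{G∖F}(s,t) + β
-- (stated as: any s-t walk of length k in G∖F yields dist_{H∖F}(s,t) ≤ k + β).
IsFTAdditivePairSpanner : ∀ {n} → ℕ → ℕ → Graph n → Fin n → Fin n → Graph n → Set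
IsFTAdditivePairSpanner f β G s t H =
  (H ⊆G G) ×
  (∀ (F : FaultSet _) → ValidFaults f G F →
     ∀ k → Walk (adjMinus G F) s t k → DistLE (adjMinus H F) s t (k + β))

-- The graph is a chain of q copies from s to t: copy c consists of two trees X_c, Y_c
-- of height h and branching k whose leaves are completely joined, and the root of Y_c
-- is linked to the root of X_(c+1).  A leaf vector a ∈ [k]^h selects a leaf of X_c;
-- cutting one spine edge per level (h faults) keeps it reachable and pushes every other
-- reachable leaf at least 2 deeper.  Selecting leaves a_c, b_c in every copy uses 2hq
-- faults, after which a potential Φ that grows by at most 1 along every surviving edge
-- except the selected leaf pairs (where it grows by 3) shows that an s-t walk avoiding
-- all selected pairs is longer than dist(s,t) by 2q.  Hence every (2q-1)-additive
-- spanner contains, in some copy, all k^2h leaf pairs: otherwise select a missing pair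
-- in every copy.  The graph has Θ(hq k^(h+1)) vertices, so |E(H)| ≥ k^2h ≈ (n/hq)^(2h/(h+1)).

module Submission where

open import Defs
open import Data.Nat using (ℕ; zero; suc; _+_; _*_; _∸_; _^_; _≤_; _<_; s≤s; z≤n)
open import Data.Product using (Σ; _×_; _,_)
open import Data.Fin using (Fin)
open import Data.Vec using (Vec)
open import Relation.Nullary using (¬_; Dec)

module Walks where

  open import Data.Nat.Properties using (+-comm; +-suc; +-identityʳ; ≤-trans; ≤-reflexive; +-monoˡ-≤)
  open import Data.Bool using (Bool; true)
  open import Relation.Binary.PropositionalEquality using (_≡_; refl; sym)

  data RWalk {A : Set} (R : A → A → Set) : A → A → ℕ → Set where
    here : ∀ {u} → RWalk R u u 0
    step : ∀ {u v w n} → R u v → RWalk R v w n → RWalk R u w (suc n)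

  module _ {A : Set} {R : A → A → Set} where

    _++ᵂ_ : ∀ {x y z m n} → RWalk R x y m → RWalk R y z n → RWalk R x z (m + n)
    here ++ᵂ q = q
    step r p ++ᵂ q = step r (p ++ᵂ q)

    castᵂ : ∀ {x y m n} → m ≡ n → RWalk R x y m → RWalk R x y n
    castᵂ refl p = p

    snocᵂ : ∀ {x y z m} → RWalk R x y m → R y z → RWalk R x z (suc m)
    snocᵂ {m = m} p r = castᵂ (+-comm m 1) (p ++ᵂ step r here)

    reverseᵂ : (∀ {x y} → R x y → R y x) → ∀ {x y n} → RWalk R x y n → RWalk R y x n
    reverseᵂ sym-R here = here
    reverseᵂ sym-R (step r p) = snocᵂ (reverseᵂ sym-R p) (sym-R r)

  mapᵂ : ∀ {A B : Set} {R : A → A → Set} {S : B → B → Set} (f : A → B) →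
         (∀ {x y} → R x y → S (f x) (f y)) → ∀ {x y n} → RWalk R x y n → RWalk S (f x) (f y) n
  mapᵂ f g here = here
  mapᵂ f g (step r p) = step (g r) (mapᵂ f g p)

  toWalk : ∀ {n} {A : Set} {R : A → A → Set} (Adj : Fin n → Fin n → Bool) (f : A → Fin n) →
           (∀ {x y} → R x y → Adj (f x) (f y) ≡ true) →
           ∀ {x y m} → RWalk R x y m → Walk Adj (f x) (f y) m
  toWalk Adj f g here = here
  toWalk Adj f g (step r p) = step (g r) (toWalk Adj f g p)

  lipschitz⇒potential≤length : ∀ {n} (Adj : Fin n → Fin n → Bool) (Φ : Fin n → ℕ) →
    (∀ x y → Adj x y ≡ true → Φ y ≤ suc (Φ x)) → ∀ {s t k} → Walk Adj s t k → Φ t ≤ Φ s + k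
  lipschitz⇒potential≤length Adj Φ lip {s} here = ≤-reflexive (sym (+-identityʳ (Φ s)))
  lipschitz⇒potential≤length Adj Φ lip {s} {k = suc k} (step r p) =
    ≤-trans (lipschitz⇒potential≤length Adj Φ lip p)
            (≤-trans (+-monoˡ-≤ k (lip _ _ r)) (≤-reflexive (sym (+-suc (Φ s) k))))

module Encoding where

  open import Data.Fin using (join; splitAt; combine; remQuot)
  open import Data.Fin.Properties using (splitAt-join; remQuot-combine)
  open import Data.Sum as Sum using (_⊎_; inj₁; inj₂)
  open import Data.Product using (proj₁; proj₂)
  open import Relation.Binary.PropositionalEquality using (_≡_; refl; sym; trans; cong; cong₂)

  record FinEnc (A : Set) : Set where
    field
      size : ℕ
      encode : A → Fin size
      decode : Fin size → A
      decode-encode : ∀ a → decode (encode a) ≡ a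
  open FinEnc public

  enc-Fin : ∀ m → FinEnc (Fin m)
  enc-Fin m = record { size = m ; encode = λ x → x ; decode = λ x → x ; decode-encode = λ _ → refl }

  enc-⊎ : ∀ {A B} → FinEnc A → FinEnc B → FinEnc (A ⊎ B)
  enc-⊎ EA EB = record
    { size = size EA + size EB
    ; encode = λ x → join (size EA) (size EB) (Sum.map (encode EA) (encode EB) x)
    ; decode = λ x → Sum.map (decode EA) (decode EB) (splitAt (size EA) x)
    ; decode-encode = λ x → trans (cong (Sum.map (decode EA) (decode EB))
                                        (splitAt-join (size EA) (size EB) (Sum.map (encode EA) (encode EB) x)))
                                  (decode-encode-⊎ x)
    }
    where
    decode-encode-⊎ : ∀ x → Sum.map (decode EA) (decode EB) (Sum.map (encode EA) (encode EB) x) ≡ x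
    decode-encode-⊎ (inj₁ a) = cong inj₁ (decode-encode EA a)
    decode-encode-⊎ (inj₂ b) = cong inj₂ (decode-encode EB b)

  enc-× : ∀ {A B} → FinEnc A → FinEnc B → FinEnc (A × B)
  enc-× EA EB = record
    { size = size EA * size EB
    ; encode = λ { (a , b) → combine (encode EA a) (encode EB b) }
    ; decode = λ x → let p = remQuot (size EB) x in decode EA (proj₁ p) , decode EB (proj₂ p)
    ; decode-encode = λ { (a , b) →
        trans (cong (λ p → decode EA (proj₁ p) , decode EB (proj₂ p)) (remQuot-combine (encode EA a) (encode EB b)))
              (cong₂ _,_ (decode-encode EA a) (decode-encode EB b)) }
    }

  enc-retract : ∀ {A B} → FinEnc B → (f : A → B) (g : B → A) → (∀ a → g (f a) ≡ a) → FinEnc A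
  enc-retract EB f g gf = record
    { size = size EB ; encode = λ a → encode EB (f a) ; decode = λ x → g (decode EB x)
    ; decode-encode = λ a → trans (cong g (decode-encode EB (f a))) (gf a) }

  encode-injective : ∀ {A} (E : FinEnc A) {a b} → encode E a ≡ encode E b → a ≡ b
  encode-injective E {a} {b} e = trans (sym (decode-encode E a)) (trans (cong (decode E) e) (decode-encode E b))

module EdgeCount where

  open import Data.Nat using (_<ᵇ_)
  open import Data.Nat.Properties using (<⇒<ᵇ)
  open import Data.Fin using (toℕ)
  open import Data.Fin.Properties using (injective⇒≤)
  open import Data.Bool using (Bool; true; _∧_)
  open import Data.Bool.Properties using (T-∧; T-≡)
  open import Data.List using (length; filterᵇ; cartesianProduct; allFin; lookup)
  open import Data.List.Membership.Propositional using (_∈_)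
  open import Data.List.Membership.Propositional.Properties using (∈-filter⁺; ∈-cartesianProduct⁺; ∈-allFin)
  open import Data.List.Relation.Unary.Any using (index)
  open import Data.List.Relation.Unary.Any.Properties using (lookup-index)
  open import Data.Product using (proj₁; proj₂)
  open import Relation.Nullary.Decidable using (T?)
  open import Relation.Binary.PropositionalEquality using (_≡_; sym; trans; cong)
  open import Function using (_∘_; Equivalence)
  open import Function.Definitions using (Injective)

  injection⇒≤numEdges : ∀ {n M} (H : Graph n) (g : Fin M → Fin n × Fin n) → Injective _≡_ _≡_ g →
    (∀ i → (toℕ (proj₁ (g i)) < toℕ (proj₂ (g i))) × (adj H (proj₁ (g i)) (proj₂ (g i)) ≡ true)) →
    M ≤ numEdges H
  injection⇒≤numEdges {n} {M} H g g-injective g-edge = injective⇒≤ {f = position} position-injective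
    where
    IsEdge : Fin n × Fin n → Bool
    IsEdge (u , v) = (toℕ u <ᵇ toℕ v) ∧ adj H u v
    edges = filterᵇ IsEdge (cartesianProduct (allFin n) (allFin n))
    g∈edges : ∀ i → g i ∈ edges
    g∈edges i with g i | g-edge i
    ... | (u , v) | (u<v , uv) =
      ∈-filter⁺ (T? ∘ IsEdge) (∈-cartesianProduct⁺ (∈-allFin u) (∈-allFin v))
                (Equivalence.from T-∧ (<⇒<ᵇ u<v , Equivalence.from T-≡ uv))
    position : Fin M → Fin (length edges)
    position i = index (g∈edges i)
    position-injective : ∀ {i j} → position i ≡ position j → i ≡ j
    position-injective {i} {j} e =
      g-injective (trans (lookup-index (g∈edges i)) (trans (cong (lookup edges) e) (sym (lookup-index (g∈edges j)))))

module Gadget (k₀ : ℕ) where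

  open import Data.Nat using (_⊓_; _≤?_; _<?_; z<s) renaming (_≟_ to _≟ℕ_)
  open import Data.Nat.Properties
  open import Data.Nat.Tactic.RingSolver using (solve-∀)
  open import Data.Fin using (zero; toℕ; fromℕ<) renaming (_≟_ to _≟ᶠ_)
  open import Data.Fin.Properties using (toℕ-injective; toℕ-fromℕ<; toℕ<n)
  open import Data.Bool using (Bool; true; false; if_then_else_)
  open import Data.Vec using ([]; _∷_)
  open import Data.List using (List; []; _∷_; _++_; map; length)
  open import Data.List.Properties using (length-++; length-map)
  open import Data.List.Membership.Propositional using (_∈_)
  open import Data.List.Relation.Unary.Any using (here)
  open import Data.List.Membership.Propositional.Properties using (∈-map⁻; ∈-map⁺; ∈-++⁺ʳ; ∈-++⁻)
  open import Data.Sum using (_⊎_; inj₁; inj₂)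
  open import Data.Empty using (⊥-elim)
  open import Function using (_∘_)
  open import Relation.Nullary using (yes; no; contradiction)
  open import Relation.Nullary.Decidable using (⌊_⌋)
  open import Relation.Binary using (Tri; tri<; tri≈; tri>)
  open import Relation.Binary.PropositionalEquality
  open Encoding
  open Walks

  k : ℕ
  k = suc k₀

  maxLeafDepth : ℕ → ℕ
  maxLeafDepth zero = 0
  maxLeafDepth (suc r) = k + k₀ * (maxLeafDepth r + 2) + maxLeafDepth r

  stride : ℕ → ℕ
  stride r = suc (maxLeafDepth r + 2)

  pathBound : ℕ → ℕ
  pathBound r = k * stride r

  strides : Fin k → ℕ
  strides i = k₀ ∸ toℕ i

  pathLength : ℕ → Fin k → ℕ
  pathLength r i = strides i * stride r

  -- A tree of height r + 1 is a spine 0, …, k-1; spine i carries a path of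
  -- pathLength r i vertices leading to the root of the subtree child i.  Path
  -- vertices are indexed by a common bound; those beyond pathLength r i are
  -- isolated padding.
  data Node : ℕ → Set where
    tip : Node zero
    spine : ∀ {r} → Fin k → Node (suc r)
    path : ∀ {r} → Fin k → Fin (pathBound r) → Node (suc r)
    child : ∀ {r} → Fin k → Node r → Node (suc r)

  root : ∀ {r} → Node r
  root {zero} = tip
  root {suc r} = spine zero

  childOffset : ℕ → Fin k → ℕ
  childOffset r i = suc (toℕ i + pathLength r i)

  depth : ∀ {r} → Node r → ℕ
  depth tip = 0
  depth (spine i) = toℕ i
  depth (path i m) = suc (toℕ i + toℕ m)
  depth {suc r} (child i v) = childOffset r i + depth v

  isLeaf : ∀ {r} → Node r → Bool
  isLeaf tip = true
  isLeaf (spine _) = false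
  isLeaf (path _ _) = false
  isLeaf (child _ v) = isLeaf v

  leaf : ∀ {r} → Vec (Fin k) r → Node r
  leaf [] = tip
  leaf (i ∷ a) = child i (leaf a)

  enc-Node : ∀ r → FinEnc (Node r)
  enc-Node zero = enc-retract (enc-Fin 1) (λ _ → zero) (λ _ → tip) (λ { tip → refl })
  enc-Node (suc r) =
    enc-retract (enc-⊎ (enc-⊎ (enc-Fin k) (enc-× (enc-Fin k) (enc-Fin (pathBound r)))) (enc-× (enc-Fin k) (enc-Node r)))
                to from from-to
    where
    to : Node (suc r) → (Fin k ⊎ (Fin k × Fin (pathBound r))) ⊎ (Fin k × Node r)
    to (spine i) = inj₁ (inj₁ i)
    to (path i m) = inj₁ (inj₂ (i , m))
    to (child i v) = inj₂ (i , v)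
    from : (Fin k ⊎ (Fin k × Fin (pathBound r))) ⊎ (Fin k × Node r) → Node (suc r)
    from (inj₁ (inj₁ i)) = spine i
    from (inj₁ (inj₂ (i , m))) = path i m
    from (inj₂ (i , v)) = child i v
    from-to : ∀ v → from (to v) ≡ v
    from-to (spine i) = refl
    from-to (path i m) = refl
    from-to (child i v) = refl

  _≟ᴺ_ : ∀ {r} (u v : Node r) → Dec (u ≡ v)
  _≟ᴺ_ {r} u v with encode (enc-Node r) u ≟ᶠ encode (enc-Node r) v
  ... | yes e = yes (encode-injective (enc-Node r) e)
  ... | no ne = no (ne ∘ cong (encode (enc-Node r)))

  data Arc : ∀ {r} → Node r → Node r → Set where
    spine-step : ∀ {r} {i i' : Fin k} → toℕ i' ≡ suc (toℕ i) → Arc {suc r} (spine i) (spine i')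
    spine-path : ∀ {r} {i} {m : Fin (pathBound r)} → toℕ m ≡ 0 → 0 < pathLength r i → Arc {suc r} (spine i) (path i m)
    spine-child : ∀ {r} {i} → pathLength r i ≡ 0 → Arc {suc r} (spine i) (child i root)
    path-step : ∀ {r} {i} {m m' : Fin (pathBound r)} → toℕ m' ≡ suc (toℕ m) → toℕ m' < pathLength r i →
                Arc {suc r} (path i m) (path i m')
    path-child : ∀ {r} {i} {m : Fin (pathBound r)} → suc (toℕ m) ≡ pathLength r i → Arc {suc r} (path i m) (child i root)
    child-arc : ∀ {r} {i} {v w : Node r} → Arc v w → Arc (child i v) (child i w)

  arc? : ∀ {r} (u v : Node r) → Dec (Arc u v)
  arc? tip tip = no λ ()
  arc? (spine i) (spine i') with toℕ i' ≟ℕ suc (toℕ i)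
  ... | yes e = yes (spine-step e)
  ... | no ne = no λ { (spine-step e) → ne e }
  arc? {suc r} (spine i) (path i' m) with i ≟ᶠ i' | toℕ m ≟ℕ 0 | 0 <? pathLength r i
  ... | yes refl | yes e | yes l = yes (spine-path e l)
  ... | no ne | _ | _ = no λ { (spine-path _ _) → ne refl }
  ... | yes refl | no ne | _ = no λ { (spine-path e _) → ne e }
  ... | yes refl | yes _ | no nl = no λ { (spine-path _ l) → nl l }
  arc? {suc r} (spine i) (child i' v) with i ≟ᶠ i' | v ≟ᴺ root | pathLength r i ≟ℕ 0
  ... | yes refl | yes refl | yes e = yes (spine-child e)
  ... | no ne | _ | _ = no λ { (spine-child _) → ne refl }
  ... | yes refl | no ne | _ = no λ { (spine-child _) → ne refl }
  ... | yes refl | yes refl | no ne = no λ { (spine-child e) → ne e }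
  arc? (path _ _) (spine _) = no λ ()
  arc? {suc r} (path i m) (path i' m') with i ≟ᶠ i' | toℕ m' ≟ℕ suc (toℕ m) | toℕ m' <? pathLength r i
  ... | yes refl | yes e | yes l = yes (path-step e l)
  ... | no ne | _ | _ = no λ { (path-step _ _) → ne refl }
  ... | yes refl | no ne | _ = no λ { (path-step e _) → ne e }
  ... | yes refl | yes _ | no nl = no λ { (path-step _ l) → nl l }
  arc? {suc r} (path i m) (child i' v) with i ≟ᶠ i' | v ≟ᴺ root | suc (toℕ m) ≟ℕ pathLength r i
  ... | yes refl | yes refl | yes e = yes (path-child e)
  ... | no ne | _ | _ = no λ { (path-child _) → ne refl }
  ... | yes refl | no ne | _ = no λ { (path-child _) → ne refl }
  ... | yes refl | yes refl | no ne = no λ { (path-child e) → ne e }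
  arc? (child _ _) (spine _) = no λ ()
  arc? (child _ _) (path _ _) = no λ ()
  arc? (child i v) (child i' w) with i ≟ᶠ i' | arc? v w
  ... | yes refl | yes a = yes (child-arc a)
  ... | no ne | _ = no λ { (child-arc _) → ne refl }
  ... | yes refl | no na = no λ { (child-arc a) → na a }

  depth-root : ∀ {r} → depth (root {r}) ≡ 0
  depth-root {zero} = refl
  depth-root {suc r} = refl

  depth-arc : ∀ {r} {u v : Node r} → Arc u v → depth v ≡ suc (depth u)
  depth-arc (spine-step e) = e
  depth-arc (spine-path {i = i} e _) = cong suc (trans (cong (toℕ i +_) e) (+-identityʳ (toℕ i)))
  depth-arc {suc r} (spine-child {i = i} e) = begin
    childOffset r i + depth (root {r})   ≡⟨ cong₂ _+_ (cong (λ L → suc (toℕ i + L)) e) (depth-root {r}) ⟩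
    suc (toℕ i + 0) + 0                  ≡⟨ +-identityʳ _ ⟩
    suc (toℕ i + 0)                      ≡⟨ cong suc (+-identityʳ (toℕ i)) ⟩
    suc (toℕ i)                          ∎
    where open ≡-Reasoning
  depth-arc (path-step {i = i} e _) = cong suc (trans (cong (toℕ i +_) e) (+-suc (toℕ i) _))
  depth-arc {suc r} (path-child {i = i} {m = m} e) = begin
    childOffset r i + depth (root {r})   ≡⟨ cong₂ _+_ (cong (λ L → suc (toℕ i + L)) (sym e)) (depth-root {r}) ⟩
    suc (toℕ i + suc (toℕ m)) + 0        ≡⟨ +-identityʳ _ ⟩
    suc (toℕ i + suc (toℕ m))            ≡⟨ cong suc (+-suc (toℕ i) (toℕ m)) ⟩
    suc (suc (toℕ i + toℕ m))            ∎
    where open ≡-Reasoning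
  depth-arc {suc r} (child-arc {i = i} {v = v} ar) =
    trans (cong (childOffset r i +_) (depth-arc ar)) (+-suc (childOffset r i) (depth v))

  arc-irrefl : ∀ {r} {u : Node r} → ¬ Arc u u
  arc-irrefl a = <-irrefl refl (≤-reflexive (sym (depth-arc a)))

  arc-asym : ∀ {r} {u v : Node r} → Arc u v → ¬ Arc v u
  arc-asym uv vu = <-irrefl refl (≤-trans (≤-reflexive (sym (depth-arc uv))) (≤-trans (n≤1+n _) (≤-reflexive (sym (depth-arc vu)))))

  data Fault : ∀ {r} → Vec (Fin k) r → Node r → Node r → Set where
    fault-here : ∀ {r} {i i' : Fin k} {a : Vec (Fin k) r} → toℕ i' ≡ suc (toℕ i) → Fault (i ∷ a) (spine i) (spine i')
    fault-child : ∀ {r} {i} {a : Vec (Fin k) r} {v w : Node r} → Fault a v w → Fault (i ∷ a) (child i v) (child i w)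

  Fault⇒Arc : ∀ {r} {a : Vec (Fin k) r} {u v} → Fault a u v → Arc u v
  Fault⇒Arc (fault-here e) = spine-step e
  Fault⇒Arc (fault-child f) = child-arc (Fault⇒Arc f)

  fault-spine-index : ∀ {r} {j : Fin k} {a : Vec (Fin k) r} {i i'} → Fault (j ∷ a) (spine i) (spine i') → i ≡ j
  fault-spine-index (fault-here _) = refl

  fault-child⁻¹ : ∀ {r} {j : Fin k} {a : Vec (Fin k) r} {i i' v w} → Fault (j ∷ a) (child i v) (child i' w) → Fault a v w
  fault-child⁻¹ (fault-child f) = f

  spineFault : ∀ {r} (i : Fin k) → Dec (suc (toℕ i) < k) → List (Node (suc r) × Node (suc r))
  spineFault i (yes p) = (spine i , spine (fromℕ< p)) ∷ []
  spineFault i (no _) = []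

  childPair : ∀ {r} → Fin k → Node r × Node r → Node (suc r) × Node (suc r)
  childPair i (v , w) = (child i v , child i w)

  faults : ∀ {r} → Vec (Fin k) r → List (Node r × Node r)
  faults [] = []
  faults (i ∷ a) = spineFault i (suc (toℕ i) <? k) ++ map (childPair i) (faults a)

  faults-complete : ∀ {r} {a : Vec (Fin k) r} {u v} → Fault a u v → (u , v) ∈ faults a
  faults-complete {suc r} {i ∷ a} (fault-here {i' = i'} e) with suc (toℕ i) <? k
  ... | yes p = here (cong (λ x → (spine i , spine x)) (toℕ-injective (trans e (sym (toℕ-fromℕ< p)))))
  ... | no np = ⊥-elim (np (subst (_< k) e (toℕ<n i')))
  faults-complete {suc r} {i ∷ a} (fault-child f) =
    ∈-++⁺ʳ (spineFault i (suc (toℕ i) <? k)) (∈-map⁺ (childPair i) (faults-complete f))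

  faults-sound : ∀ {r} (a : Vec (Fin k) r) {u v} → (u , v) ∈ faults a → Fault a u v
  faults-sound (i ∷ a) m with ∈-++⁻ (spineFault i (suc (toℕ i) <? k)) m
  faults-sound (i ∷ a) m | inj₁ h with suc (toℕ i) <? k
  faults-sound (i ∷ a) m | inj₁ (here refl) | yes p = fault-here (toℕ-fromℕ< p)
  faults-sound (i ∷ a) m | inj₂ h with ∈-map⁻ (childPair i) h
  ... | _ , m' , refl = fault-child (faults-sound a m')

  spineFault-length : ∀ {r} (i : Fin k) d → length (spineFault {r} i d) ≤ 1
  spineFault-length i (yes _) = s≤s z≤n
  spineFault-length i (no _) = z≤n

  faults-length : ∀ {r} (a : Vec (Fin k) r) → length (faults a) ≤ r
  faults-length [] = z≤n
  faults-length (i ∷ a) = begin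
    length (spineFault i d ++ map (childPair i) (faults a))     ≡⟨ length-++ (spineFault i d) ⟩
    length (spineFault i d) + length (map (childPair i) (faults a)) ≡⟨ cong (length (spineFault i d) +_) (length-map (childPair i) (faults a)) ⟩
    length (spineFault i d) + length (faults a)                 ≤⟨ +-mono-≤ (spineFault-length i d) (faults-length a) ⟩
    1 + _                                                        ∎
    where open ≤-Reasoning
          d = suc (toℕ i) <? k

  branchReach : ℕ → ℕ → Bool → Bool
  branchReach i j b with <-cmp i j
  ... | tri< _ _ _ = true
  ... | tri≈ _ _ _ = b
  ... | tri> _ _ _ = false

  branchReach-≡ : ∀ {i j b} → i ≡ j → branchReach i j b ≡ b
  branchReach-≡ {i} {j} e with <-cmp i j
  ... | tri< l _ _ = ⊥-elim (<⇒≢ l e)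
  ... | tri≈ _ _ _ = refl
  ... | tri> _ _ g = ⊥-elim (<⇒≢ g (sym e))

  branchReach-> : ∀ {i j b} → j < i → branchReach i j b ≡ false
  branchReach-> {i} {j} g with <-cmp i j
  ... | tri< l _ _ = ⊥-elim (<⇒≯ l g)
  ... | tri≈ _ e _ = ⊥-elim (<⇒≢ g (sym e))
  ... | tri> _ _ _ = refl

  branchReach-true : ∀ i j → branchReach i j true ≡ ⌊ i ≤? j ⌋
  branchReach-true i j with <-cmp i j | i ≤? j
  ... | tri< _ _ _ | yes _ = refl
  ... | tri< l _ _ | no n = ⊥-elim (n (<⇒≤ l))
  ... | tri≈ _ _ _ | yes _ = refl
  ... | tri≈ _ e _ | no n = ⊥-elim (n (≤-reflexive e))
  ... | tri> _ _ _ | no _ = refl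
  ... | tri> _ _ g | yes l = ⊥-elim (<⇒≱ g l)

  branchReach-cong : ∀ i j {b b'} → (i ≡ j → b ≡ b') → branchReach i j b ≡ branchReach i j b'
  branchReach-cong i j h with <-cmp i j
  ... | tri< _ _ _ = refl
  ... | tri≈ _ e _ = h e
  ... | tri> _ _ _ = refl

  -- reachability from the root once the faults of the leaf vector are removed
  reachable : ∀ {r} → Vec (Fin k) r → Node r → Bool
  reachable [] tip = true
  reachable (j ∷ a) (spine i) = ⌊ toℕ i ≤? toℕ j ⌋
  reachable (j ∷ a) (path i _) = ⌊ toℕ i ≤? toℕ j ⌋
  reachable (j ∷ a) (child i v) = branchReach (toℕ i) (toℕ j) (reachable a v)

  reachable-root : ∀ {r} (a : Vec (Fin k) r) → reachable a root ≡ true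
  reachable-root [] = refl
  reachable-root (j ∷ a) with 0 ≤? toℕ j
  ... | yes _ = refl
  ... | no n = ⊥-elim (n z≤n)

  ≤?-suc : ∀ i j → i ≢ j → ⌊ i ≤? j ⌋ ≡ ⌊ suc i ≤? j ⌋
  ≤?-suc i j ne with i ≤? j | suc i ≤? j
  ... | yes _ | yes _ = refl
  ... | no _ | no _ = refl
  ... | yes l | no n = ⊥-elim (n (≤∧≢⇒< l ne))
  ... | no n | yes l = ⊥-elim (n (<⇒≤ l))

  reachable-arc : ∀ {r} (a : Vec (Fin k) r) {u v} → Arc u v → ¬ Fault a u v → reachable a u ≡ reachable a v
  reachable-arc (j ∷ a) (spine-step {i = i} e) nf with toℕ i ≟ℕ toℕ j
  ... | yes i≡j with toℕ-injective i≡j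
  ...   | refl = ⊥-elim (nf (fault-here e))
  reachable-arc (j ∷ a) (spine-step {i = i} e) nf | no i≢j rewrite e = ≤?-suc (toℕ i) (toℕ j) i≢j
  reachable-arc (j ∷ a) (spine-path _ _) nf = refl
  reachable-arc (j ∷ a) (spine-child {i = i} _) nf rewrite reachable-root a = sym (branchReach-true (toℕ i) (toℕ j))
  reachable-arc (j ∷ a) (path-step _ _) nf = refl
  reachable-arc (j ∷ a) (path-child {i = i} _) nf rewrite reachable-root a = sym (branchReach-true (toℕ i) (toℕ j))
  reachable-arc (j ∷ a) (child-arc {i = i} {v = v} {w = w} ar) nf =
    branchReach-cong (toℕ i) (toℕ j) (λ e → inside (toℕ-injective e))
    where
    inside : i ≡ j → reachable a v ≡ reachable a w
    inside refl = reachable-arc a ar (nf ∘ fault-child)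

  strides+index : (i : Fin k) → toℕ i + strides i ≡ k₀
  strides+index i = m+[n∸m]≡n (≤-pred (toℕ<n i))

  childOffset-bound : ∀ r (i : Fin k) → childOffset r i ≤ k + k₀ * (maxLeafDepth r + 2)
  childOffset-bound r i = s≤s (begin
    toℕ i + strides i * suc X              ≡⟨ cong (toℕ i +_) (*-suc (strides i) X) ⟩
    toℕ i + (strides i + strides i * X)    ≡⟨ sym (+-assoc (toℕ i) (strides i) (strides i * X)) ⟩
    (toℕ i + strides i) + strides i * X    ≡⟨ cong (_+ strides i * X) (strides+index i) ⟩
    k₀ + strides i * X                     ≤⟨ +-monoʳ-≤ k₀ (*-monoˡ-≤ X (m∸n≤m k₀ (toℕ i))) ⟩
    k₀ + k₀ * X                            ∎)
    where open ≤-Reasoning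
          X = maxLeafDepth r + 2

  leaf-depth≤max : ∀ {r} (v : Node r) → isLeaf v ≡ true → depth v ≤ maxLeafDepth r
  leaf-depth≤max tip _ = z≤n
  leaf-depth≤max {suc r} (child i v) v-leaf = +-mono-≤ (childOffset-bound r i) (leaf-depth≤max v v-leaf)

  -- Each further spine step shortens the hanging path by a whole stride, more
  -- than a subtree can make up.
  childOffset-gap : ∀ r (i j : Fin k) → toℕ i < toℕ j → childOffset r j + (maxLeafDepth r + 2) ≤ childOffset r i
  childOffset-gap r i j i<j = begin
    suc (toℕ j + pathLength r j) + X        ≡⟨ cong (λ z → suc (z + pathLength r j) + X) j≡i+1+e ⟩
    suc (I + suc e + B * suc X) + X         ≡⟨ swap-X-e I e B X ⟩
    suc (I + suc X + B * suc X) + e         ≤⟨ +-monoʳ-≤ (suc (I + suc X + B * suc X)) (m≤m*n e (suc X)) ⟩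
    suc (I + suc X + B * suc X) + e * suc X ≡⟨ collect I e B X ⟩
    suc (I + (suc e + B) * suc X)           ≡⟨ cong (λ z → suc (I + z * suc X)) (sym strides-i) ⟩
    suc (toℕ i + pathLength r i)            ∎
    where
    open ≤-Reasoning
    X = maxLeafDepth r + 2
    I = toℕ i
    B = strides j
    e = toℕ j ∸ suc I
    j≡i+1+e : toℕ j ≡ I + suc e
    j≡i+1+e = trans (sym (m+[n∸m]≡n i<j)) (sym (+-suc I e))
    strides-i : strides i ≡ suc e + B
    strides-i = begin-equality
      k₀ ∸ I                 ≡⟨ cong (_∸ I) (sym (strides+index j)) ⟩
      (toℕ j + B) ∸ I        ≡⟨ cong (λ z → (z + B) ∸ I) j≡i+1+e ⟩
      (I + suc e + B) ∸ I    ≡⟨ cong (_∸ I) (+-assoc I (suc e) B) ⟩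
      (I + (suc e + B)) ∸ I  ≡⟨ m+n∸m≡n I (suc e + B) ⟩
      suc e + B              ∎
    swap-X-e : ∀ I e B X → suc (I + suc e + B * suc X) + X ≡ suc (I + suc X + B * suc X) + e
    swap-X-e = solve-∀
    collect : ∀ I e B X → suc (I + suc X + B * suc X) + e * suc X ≡ suc (I + (suc e + B) * suc X)
    collect = solve-∀

  isLeaf-leaf : ∀ {r} (a : Vec (Fin k) r) → isLeaf (leaf a) ≡ true
  isLeaf-leaf [] = refl
  isLeaf-leaf (i ∷ a) = isLeaf-leaf a

  reachable-leaf : ∀ {r} (a : Vec (Fin k) r) → reachable a (leaf a) ≡ true
  reachable-leaf [] = refl
  reachable-leaf (j ∷ a) = trans (branchReach-≡ refl) (reachable-leaf a)

  leaf-depth-gap : ∀ {r} (a : Vec (Fin k) r) (v : Node r) → isLeaf v ≡ true → reachable a v ≡ true →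
                   v ≢ leaf a → depth (leaf a) + 2 ≤ depth v
  leaf-depth-gap [] tip _ _ tip≢tip = ⊥-elim (tip≢tip refl)
  leaf-depth-gap {suc r} (j ∷ a) (child i v) v-leaf v-reach v≢leaf = by-branch (<-cmp (toℕ i) (toℕ j))
    where
    open ≤-Reasoning
    by-branch : Tri (toℕ i < toℕ j) (toℕ i ≡ toℕ j) (toℕ j < toℕ i) → depth (leaf (j ∷ a)) + 2 ≤ depth (child i v)
    by-branch (tri> _ _ j<i) = contradiction (trans (sym (branchReach-> j<i)) v-reach) λ ()
    by-branch (tri< i<j _ _) = begin
      childOffset r j + depth (leaf a) + 2        ≡⟨ +-assoc (childOffset r j) (depth (leaf a)) 2 ⟩
      childOffset r j + (depth (leaf a) + 2)      ≤⟨ +-monoʳ-≤ (childOffset r j) (+-monoˡ-≤ 2 (leaf-depth≤max (leaf a) (isLeaf-leaf a))) ⟩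
      childOffset r j + (maxLeafDepth r + 2)      ≤⟨ childOffset-gap r i j i<j ⟩
      childOffset r i                             ≤⟨ m≤m+n (childOffset r i) (depth v) ⟩
      childOffset r i + depth v                   ∎
    by-branch (tri≈ _ i≡j _) = same-branch (toℕ-injective i≡j) (trans (sym (branchReach-≡ i≡j)) v-reach)
      where
      same-branch : i ≡ j → reachable a v ≡ true → depth (leaf (j ∷ a)) + 2 ≤ depth (child i v)
      same-branch refl v-reach′ = begin
        childOffset r j + depth (leaf a) + 2        ≡⟨ +-assoc (childOffset r j) (depth (leaf a)) 2 ⟩
        childOffset r j + (depth (leaf a) + 2)      ≤⟨ +-monoʳ-≤ (childOffset r j) (leaf-depth-gap a v v-leaf v-reach′ (v≢leaf ∘ cong (child j))) ⟩
        childOffset r j + depth v                   ∎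

  capped : ∀ {r} → Vec (Fin k) r → ℕ → Node r → ℕ
  capped a C v = if reachable a v then depth v ⊓ C else C

  capped-step : ∀ {r} (a : Vec (Fin k) r) C {u v : Node r} → reachable a u ≡ reachable a v → depth v ≡ suc (depth u) →
                (capped a C v ≤ suc (capped a C u)) × (capped a C u ≤ suc (capped a C v))
  capped-step a C {u} {v} e v-deeper with reachable a u | reachable a v
  capped-step a C {u} {v} refl v-deeper | true | true rewrite v-deeper =
    ⊓-monoʳ-≤ (suc (depth u)) (n≤1+n C) , ≤-trans (⊓-monoˡ-≤ C (n≤1+n (depth u))) (n≤1+n _)
  capped-step a C {u} {v} refl v-deeper | false | false = n≤1+n C , n≤1+n C

  capped-≤ : ∀ {r} (a : Vec (Fin k) r) C (v : Node r) → capped a C v ≤ C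
  capped-≤ a C v with reachable a v
  ... | true = m⊓n≤n (depth v) C
  ... | false = ≤-refl

  capped-root : ∀ {r} (a : Vec (Fin k) r) C → capped a C root ≡ 0
  capped-root {r} a C rewrite reachable-root a | depth-root {r} = refl

  capped-leaf-selected : ∀ {r} (a : Vec (Fin k) r) → capped a (depth (leaf a) + 2) (leaf a) ≡ depth (leaf a)
  capped-leaf-selected a rewrite reachable-leaf a = m≤n⇒m⊓n≡m (m≤m+n (depth (leaf a)) 2)

  capped-leaf-other : ∀ {r} (a : Vec (Fin k) r) {v : Node r} → isLeaf v ≡ true → v ≢ leaf a →
                      capped a (depth (leaf a) + 2) v ≡ depth (leaf a) + 2
  capped-leaf-other a {v} v-leaf v≢leaf with reachable a v in v-reach
  ... | true = m≥n⇒m⊓n≡n (leaf-depth-gap a v v-leaf v-reach v≢leaf)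
  ... | false = refl

  capped-leaf-≥ : ∀ {r} (a : Vec (Fin k) r) {v : Node r} → isLeaf v ≡ true → depth (leaf a) ≤ capped a (depth (leaf a) + 2) v
  capped-leaf-≥ a {v} v-leaf with v ≟ᴺ leaf a
  ... | yes refl = ≤-reflexive (sym (capped-leaf-selected a))
  ... | no v≢leaf = ≤-trans (m≤m+n (depth (leaf a)) 2) (≤-reflexive (sym (capped-leaf-other a v-leaf v≢leaf)))

  LiveArc : ∀ {r} → Vec (Fin k) r → Node r → Node r → Set
  LiveArc a u v = Arc u v × ¬ Fault a u v

  spineWalk : ∀ {r} (j : Fin k) (a : Vec (Fin k) r) (i : Fin k) d → toℕ i + d ≡ toℕ j →
              RWalk (LiveArc (j ∷ a)) (spine i) (spine j) d
  spineWalk j a i zero i+0≡j with toℕ-injective (trans (sym (+-identityʳ (toℕ i))) i+0≡j)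
  ... | refl = here
  spineWalk j a i (suc d) i+d≡j = step (spine-step (toℕ-fromℕ< i+1<k) , not-fault) (spineWalk j a (fromℕ< i+1<k) d i+1+d≡j)
    where
    i<j : toℕ i < toℕ j
    i<j = subst (toℕ i <_) i+d≡j (m<m+n (toℕ i) z<s)
    i+1<k : suc (toℕ i) < k
    i+1<k = ≤-trans (s≤s i<j) (toℕ<n j)
    not-fault : ¬ Fault (j ∷ a) (spine i) (spine (fromℕ< i+1<k))
    not-fault f = <-irrefl (cong toℕ (fault-spine-index f)) i<j
    i+1+d≡j : toℕ (fromℕ< i+1<k) + d ≡ toℕ j
    i+1+d≡j = trans (cong (_+ d) (toℕ-fromℕ< i+1<k)) (trans (sym (+-suc (toℕ i) d)) i+d≡j)

  pathLength≤pathBound : ∀ r (j : Fin k) → pathLength r j ≤ pathBound r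
  pathLength≤pathBound r j = *-monoˡ-≤ (stride r) (≤-trans (m∸n≤m k₀ (toℕ j)) (n≤1+n k₀))

  pathWalk : ∀ {r} (j : Fin k) (a : Vec (Fin k) r) (m : Fin (pathBound r)) d → suc (toℕ m + d) ≡ pathLength r j →
             RWalk (LiveArc (j ∷ a)) (path j m) (child j root) (suc d)
  pathWalk j a m zero m+1≡L = step (path-child (trans (cong suc (sym (+-identityʳ (toℕ m)))) m+1≡L) , λ ()) here
  pathWalk {r} j a m (suc d) m+d+2≡L =
    step (path-step (toℕ-fromℕ< m+1<bound) (subst (_< pathLength r j) (sym (toℕ-fromℕ< m+1<bound)) m+1<L) , λ ())
         (pathWalk j a (fromℕ< m+1<bound) d m+1+d+1≡L)
    where
    m+1<L : suc (toℕ m) < pathLength r j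
    m+1<L = subst (suc (toℕ m) <_) m+d+2≡L (s≤s (≤-trans (m≤m+n (suc (toℕ m)) d) (≤-reflexive (sym (+-suc (toℕ m) d)))))
    m+1<bound : suc (toℕ m) < pathBound r
    m+1<bound = <-≤-trans m+1<L (pathLength≤pathBound r j)
    m+1+d+1≡L : suc (toℕ (fromℕ< m+1<bound) + d) ≡ pathLength r j
    m+1+d+1≡L = trans (cong (λ x → suc (x + d)) (toℕ-fromℕ< m+1<bound)) (trans (cong suc (sym (+-suc (toℕ m) d))) m+d+2≡L)

  branchWalk : ∀ {r} (j : Fin k) (a : Vec (Fin k) r) → RWalk (LiveArc (j ∷ a)) (spine j) (child j root) (suc (pathLength r j))
  branchWalk {r} j a with pathLength r j in L≡
  ... | zero = step (spine-child L≡ , λ ()) here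
  ... | suc d = step (spine-path refl (subst (0 <_) (sym L≡) z<s) , λ ()) (pathWalk j a zero d (sym L≡))

  walk-to-leaf : ∀ {r} (a : Vec (Fin k) r) → RWalk (LiveArc a) root (leaf a) (depth (leaf a))
  walk-to-leaf [] = here
  walk-to-leaf {suc r} (j ∷ a) = castᵂ (cong (_+ depth (leaf a)) (+-suc (toℕ j) (pathLength r j)))
      ((spineWalk j a zero (toℕ j) refl ++ᵂ branchWalk j a) ++ᵂ mapᵂ (child j) lift (walk-to-leaf a))
    where
    lift : ∀ {v w} → LiveArc a v w → LiveArc (j ∷ a) (child j v) (child j w)
    lift (ar , nf) = child-arc ar , nf ∘ fault-child⁻¹

  child-injective : ∀ {r} {i i' : Fin k} {v v' : Node r} → child i v ≡ child i' v' → (i ≡ i') × (v ≡ v')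
  child-injective refl = refl , refl

  leaf-injective : ∀ {r} {a a' : Vec (Fin k) r} → leaf a ≡ leaf a' → a ≡ a'
  leaf-injective {zero} {[]} {[]} _ = refl
  leaf-injective {suc r} {i ∷ a} {i' ∷ a'} e with child-injective e
  ... | i≡i' , a≡a' = cong₂ _∷_ i≡i' (leaf-injective a≡a')


module Bounds (k₁ : ℕ) where

  open import Data.Nat.Properties
  open import Data.Nat.Tactic.RingSolver using (solve-∀)
  open import Relation.Binary.PropositionalEquality
  open Encoding
  open Gadget (suc k₁)

  maxLeafDepth-bound : ∀ r → maxLeafDepth r + 4 ≤ 4 * k ^ r
  maxLeafDepth-bound zero = ≤-refl
  maxLeafDepth-bound (suc r) = begin
    maxLeafDepth (suc r) + 4         ≤⟨ m≤m+n _ k₁ ⟩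
    maxLeafDepth (suc r) + 4 + k₁    ≡⟨ factor k₁ (maxLeafDepth r) ⟩
    k * (maxLeafDepth r + 4)         ≤⟨ *-monoʳ-≤ k (maxLeafDepth-bound r) ⟩
    k * (4 * k ^ r)                  ≡⟨ *-comm-4 k (k ^ r) ⟩
    4 * (k * k ^ r)                  ∎
    where
    open ≤-Reasoning
    factor : ∀ a D → suc (suc a) + suc a * (D + 2) + D + 4 + a ≡ suc (suc a) * (D + 4)
    factor = solve-∀
    *-comm-4 : ∀ a b → a * (4 * b) ≡ 4 * (a * b)
    *-comm-4 = solve-∀

  nodeCount : ℕ → ℕ
  nodeCount r = size (enc-Node r)

  nodeCount-bound : ∀ r → nodeCount r ≤ 5 * r * k ^ suc r + 1
  nodeCount-bound zero = ≤-refl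
  nodeCount-bound (suc r) = begin
    k + k * (k * stride r) + k * nodeCount r
      ≤⟨ +-mono-≤ (+-monoʳ-≤ k (*-monoʳ-≤ k (*-monoʳ-≤ k stride-bound))) (*-monoʳ-≤ k (nodeCount-bound r)) ⟩
    k + k * (k * (4 * P)) + k * (5 * r * (k * P) + 1)
      ≡⟨ expand k P r ⟩
    (k + k) + 4 * (k * (k * P)) + 5 * r * (k * (k * P))
      ≤⟨ +-monoˡ-≤ (5 * r * (k * (k * P))) (+-monoˡ-≤ (4 * (k * (k * P))) k+k≤k²P+1) ⟩
    (k * (k * P) + 1) + 4 * (k * (k * P)) + 5 * r * (k * (k * P))
      ≡⟨ collect (k * (k * P)) r ⟩
    5 * suc r * (k * (k * P)) + 1
      ∎
    where
    open ≤-Reasoning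
    P = k ^ r
    stride-bound : stride r ≤ 4 * P
    stride-bound = ≤-trans (n≤1+n (stride r)) (≤-trans (≤-reflexive (suc-suc (maxLeafDepth r))) (maxLeafDepth-bound r))
      where suc-suc : ∀ D → suc (suc (D + 2)) ≡ D + 4
            suc-suc = solve-∀
    expand : ∀ k P r → k + k * (k * (4 * P)) + k * (5 * r * (k * P) + 1) ≡ (k + k) + 4 * (k * (k * P)) + 5 * r * (k * (k * P))
    expand = solve-∀
    collect : ∀ X r → (X + 1) + 4 * X + 5 * r * X ≡ 5 * suc r * X + 1
    collect = solve-∀
    k+k≤k²P+1 : k + k ≤ k * (k * P) + 1
    k+k≤k²P+1 = begin
      k + k        ≡⟨ double k ⟩
      k * 2        ≤⟨ *-monoʳ-≤ k (*-mono-≤ {2} {k} {1} {P} (s≤s (s≤s z≤n)) (m^n>0 k r)) ⟩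
      k * (k * P)  ≤⟨ m≤m+n _ 1 ⟩
      k * (k * P) + 1 ∎
      where double : ∀ a → a + a ≡ a * 2
            double = solve-∀

module Build (k₁ h q₀ : ℕ) where

  open import Data.Nat using () renaming (_≟_ to _≟ℕ_)
  open import Data.Nat.Properties using (<-irrefl; ≤-refl; n<1+n)
  open import Data.Fin using (zero; suc; toℕ; fromℕ<) renaming (_≟_ to _≟ᶠ_)
  open import Data.Bool using (Bool; true; false; if_then_else_)
  open import Data.Bool.Properties using () renaming (_≟_ to _≟ᴮ_)
  open import Data.Sum using (_⊎_; inj₁; inj₂; swap)
  open import Function using (_∘_)
  open import Relation.Nullary.Decidable using (_×-dec_; _⊎-dec_; ¬?)
  open import Relation.Binary.PropositionalEquality
  open Encoding
  open Gadget (suc k₁)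

  q : ℕ
  q = suc q₀

  -- (c , false , v) is the vertex v of the tree X_c, (c , true , v) that of Y_c.
  V : Set
  V = Fin q × Bool × Node h

  enc-Bool : FinEnc Bool
  enc-Bool = enc-retract (enc-Fin 2) (λ b → if b then suc zero else zero) from-Fin2 (λ { false → refl ; true → refl })
    where from-Fin2 : Fin 2 → Bool
          from-Fin2 zero = false
          from-Fin2 (suc _) = true

  enc-V : FinEnc V
  enc-V = enc-× (enc-Fin q) (enc-× enc-Bool (enc-Node h))

  vertexCount : ℕ
  vertexCount = size enc-V

  Link : V → V → Set
  Link (c , σ , u) (c' , σ' , v) = (toℕ c' ≡ suc (toℕ c)) × (σ ≡ true) × (σ' ≡ false) × (u ≡ root) × (v ≡ root)

  link? : ∀ x y → Dec (Link x y)
  link? (c , σ , u) (c' , σ' , v) =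
    (toℕ c' ≟ℕ suc (toℕ c)) ×-dec (σ ≟ᴮ true) ×-dec (σ' ≟ᴮ false) ×-dec (u ≟ᴺ root) ×-dec (v ≟ᴺ root)

  Edge : V → V → Set
  Edge (c , σ , u) (c' , σ' , v) =
    ((c ≡ c') × (σ ≡ σ') × (Arc u v ⊎ Arc v u)) ⊎
    ((c ≡ c') × (σ ≢ σ') × (isLeaf u ≡ true) × (isLeaf v ≡ true)) ⊎
    (Link (c , σ , u) (c' , σ' , v) ⊎ Link (c' , σ' , v) (c , σ , u))

  edge? : ∀ x y → Dec (Edge x y)
  edge? (c , σ , u) (c' , σ' , v) =
    ((c ≟ᶠ c') ×-dec (σ ≟ᴮ σ') ×-dec (arc? u v ⊎-dec arc? v u)) ⊎-dec
    ((c ≟ᶠ c') ×-dec ¬? (σ ≟ᴮ σ') ×-dec (isLeaf u ≟ᴮ true) ×-dec (isLeaf v ≟ᴮ true)) ⊎-dec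
    (link? (c , σ , u) (c' , σ' , v) ⊎-dec link? (c' , σ' , v) (c , σ , u))

  Edge-sym : ∀ x y → Edge x y → Edge y x
  Edge-sym _ _ (inj₁ (refl , refl , p)) = inj₁ (refl , refl , swap p)
  Edge-sym _ _ (inj₂ (inj₁ (refl , σ≢σ' , u-leaf , v-leaf))) = inj₂ (inj₁ (refl , σ≢σ' ∘ sym , v-leaf , u-leaf))
  Edge-sym _ _ (inj₂ (inj₂ p)) = inj₂ (inj₂ (swap p))

  Edge-irrefl : ∀ x → ¬ Edge x x
  Edge-irrefl _ (inj₁ (_ , _ , inj₁ a)) = arc-irrefl a
  Edge-irrefl _ (inj₁ (_ , _ , inj₂ a)) = arc-irrefl a
  Edge-irrefl _ (inj₂ (inj₁ (_ , σ≢σ , _))) = σ≢σ refl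
  Edge-irrefl _ (inj₂ (inj₂ (inj₁ (e , _)))) = <-irrefl e ≤-refl
  Edge-irrefl _ (inj₂ (inj₂ (inj₂ (e , _)))) = <-irrefl e ≤-refl

  source : V
  source = (zero , false , root)

  lastCopy : Fin q
  lastCopy = fromℕ< (n<1+n q₀)

  target : V
  target = (lastCopy , true , root)


module FinGraph {V : Set} (E : Encoding.FinEnc V) (Edge : V → V → Set) (edge? : ∀ x y → Dec (Edge x y))
                (Edge-sym : ∀ x y → Edge x y → Edge y x) (Edge-irrefl : ∀ x → ¬ Edge x x)
                (n : ℕ) (size≤n : Encoding.size E ≤ n) where

  open import Data.Nat using (_<?_)
  open import Data.Fin using (toℕ; fromℕ<; inject≤) renaming (_≟_ to _≟ᶠ_)
  open import Data.Fin.Properties using (toℕ-injective; toℕ-fromℕ<; toℕ<n; toℕ-inject≤)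
  open import Data.Bool using (Bool; true; false; T; _∧_; _∨_)
  open import Data.Bool.Properties using (T-≡; ∨-zeroʳ)
  open import Data.Bool.ListAction using (any)
  open import Data.Maybe using (Maybe; just; nothing)
  open import Data.List using (List; map)
  open import Data.List.Relation.Unary.Any using (Any)
  open import Data.List.Relation.Unary.Any.Properties using (any⁺; any⁻)
  open import Data.List.Membership.Propositional using (_∈_; lose; find)
  open import Data.List.Membership.Propositional.Properties using (∈-map⁺; ∈-map⁻)
  open import Data.Product using (proj₁; proj₂)
  open import Data.Sum as Sum using (_⊎_; inj₁; inj₂)
  open import Function using (_∘_; Equivalence; mk⇔)
  open import Relation.Nullary using (yes; no; contradiction)
  open import Relation.Nullary.Decidable using (⌊_⌋; isYes≗does; does-⇔; toWitness; fromWitness)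
  open import Relation.Binary.PropositionalEquality
  open Encoding

  embed : V → Fin n
  embed v = inject≤ (encode E v) size≤n

  toℕ-embed : ∀ v → toℕ (embed v) ≡ toℕ (encode E v)
  toℕ-embed v = toℕ-inject≤ (encode E v) size≤n

  embed-injective : ∀ {u v} → embed u ≡ embed v → u ≡ v
  embed-injective {u} {v} e =
    encode-injective E (toℕ-injective (trans (sym (toℕ-embed u)) (trans (cong toℕ e) (toℕ-embed v))))

  -- Vertices of Fin n outside the image of embed are isolated.
  unembedWith : (x : Fin n) → Dec (toℕ x < size E) → Maybe V
  unembedWith x (no _) = nothing
  unembedWith x (yes p) with embed (decode E (fromℕ< p)) ≟ᶠ x
  ... | yes _ = just (decode E (fromℕ< p))
  ... | no _ = nothing

  unembed : Fin n → Maybe V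
  unembed x = unembedWith x (toℕ x <? size E)

  unembedWith-just : ∀ x d {v} → unembedWith x d ≡ just v → embed v ≡ x
  unembedWith-just x (yes p) e with embed (decode E (fromℕ< p)) ≟ᶠ x
  unembedWith-just x (yes p) refl | yes embed-v≡x = embed-v≡x

  unembed-just : ∀ x {v} → unembed x ≡ just v → embed v ≡ x
  unembed-just x = unembedWith-just x (toℕ x <? size E)

  unembedWith-embed : ∀ v d → unembedWith (embed v) d ≡ just v
  unembedWith-embed v (no ¬p) = contradiction (subst (_< size E) (sym (toℕ-embed v)) (toℕ<n (encode E v))) ¬p
  unembedWith-embed v (yes p) with embed (decode E (fromℕ< p)) ≟ᶠ embed v
  ... | yes e = cong just (embed-injective e)
  ... | no ne = contradiction (cong embed (trans (cong (decode E) fromℕ<-p≡encode) (decode-encode E v))) ne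
    where fromℕ<-p≡encode : fromℕ< p ≡ encode E v
          fromℕ<-p≡encode = toℕ-injective (trans (toℕ-fromℕ< p) (toℕ-embed v))

  unembed-embed : ∀ v → unembed (embed v) ≡ just v
  unembed-embed v = unembedWith-embed v (toℕ (embed v) <? size E)

  adjMaybe : Maybe V → Maybe V → Bool
  adjMaybe (just u) (just v) = ⌊ edge? u v ⌋
  adjMaybe _ _ = false

  adjMaybe-sym : ∀ mu mv → adjMaybe mu mv ≡ adjMaybe mv mu
  adjMaybe-sym (just u) (just v) =
    trans (isYes≗does (edge? u v))
          (trans (does-⇔ (mk⇔ (Edge-sym u v) (Edge-sym v u)) (edge? u v) (edge? v u)) (sym (isYes≗does (edge? v u))))
  adjMaybe-sym (just u) nothing = refl
  adjMaybe-sym nothing (just v) = refl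
  adjMaybe-sym nothing nothing = refl

  adjMaybe-irrefl : ∀ mu → adjMaybe mu mu ≡ false
  adjMaybe-irrefl (just u) with edge? u u
  ... | yes e = contradiction e (Edge-irrefl u)
  ... | no _ = refl
  adjMaybe-irrefl nothing = refl

  graph : Graph n
  graph = record
    { adj = λ x y → adjMaybe (unembed x) (unembed y)
    ; adj-sym = λ x y → adjMaybe-sym (unembed x) (unembed y)
    ; adj-irrefl = λ x → adjMaybe-irrefl (unembed x) }

  adj-embed : ∀ {u v} → Edge u v → adj graph (embed u) (embed v) ≡ true
  adj-embed {u} {v} e rewrite unembed-embed u | unembed-embed v =
    Equivalence.to T-≡ (fromWitness {a? = edge? u v} e)

  adj-unembed : ∀ x y → adj graph x y ≡ true → Σ V λ u → Σ V λ v → (embed u ≡ x) × (embed v ≡ y) × Edge u v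
  adj-unembed x y e with unembed x in x≡ | unembed y in y≡
  ... | just u | just v = u , v , unembed-just x x≡ , unembed-just y y≡ , toWitness {a? = edge? u v} (Equivalence.from T-≡ e)

  embedPair : V × V → Fin n × Fin n
  embedPair (x , y) = embed x , embed y

  embedFaults : List (V × V) → FaultSet n
  embedFaults = map embedPair

  private
    matches : Fin n → Fin n → Fin n × Fin n → Bool
    matches u v e = (⌊ proj₁ e ≟ᶠ u ⌋ ∧ ⌊ proj₂ e ≟ᶠ v ⌋) ∨ (⌊ proj₁ e ≟ᶠ v ⌋ ∧ ⌊ proj₂ e ≟ᶠ u ⌋)

    matches-direct : ∀ u v → matches u v (u , v) ≡ true
    matches-direct u v with u ≟ᶠ u | v ≟ᶠ v
    ... | yes _ | yes _ = refl
    ... | no u≢u | _ = contradiction refl u≢u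
    ... | yes _ | no v≢v = contradiction refl v≢v

    matches-reversed : ∀ u v → matches u v (v , u) ≡ true
    matches-reversed u v with u ≟ᶠ u | v ≟ᶠ v
    ... | yes _ | yes _ = ∨-zeroʳ _
    ... | no u≢u | _ = contradiction refl u≢u
    ... | yes _ | no v≢v = contradiction refl v≢v

    matches-sound : ∀ {u v x y} → T (matches u v (x , y)) → (x ≡ u × y ≡ v) ⊎ (x ≡ v × y ≡ u)
    matches-sound {u} {v} {x} {y} t with x ≟ᶠ u | y ≟ᶠ v | x ≟ᶠ v | y ≟ᶠ u
    matches-sound t | yes x≡u | yes y≡v | _ | _ = inj₁ (x≡u , y≡v)
    matches-sound t | _ | _ | yes x≡v | yes y≡u = inj₂ (x≡v , y≡u)
    matches-sound () | no _ | _ | no _ | _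
    matches-sound () | no _ | _ | yes _ | no _
    matches-sound () | yes _ | no _ | no _ | _
    matches-sound () | yes _ | no _ | yes _ | no _

  inF-embed⁺ : ∀ P {u v} → (u , v) ∈ P ⊎ (v , u) ∈ P → inF (embedFaults P) (embed u) (embed v) ≡ true
  inF-embed⁺ P {u} {v} uv∈ = Equivalence.to T-≡ found
    where
    direct : (u , v) ∈ P → Any (T ∘ matches (embed u) (embed v)) (embedFaults P)
    direct m = lose (∈-map⁺ embedPair m) (Equivalence.from T-≡ (matches-direct (embed u) (embed v)))
    reversed : (v , u) ∈ P → Any (T ∘ matches (embed u) (embed v)) (embedFaults P)
    reversed m = lose (∈-map⁺ embedPair m) (Equivalence.from T-≡ (matches-reversed (embed u) (embed v)))
    found : T (any (matches (embed u) (embed v)) (embedFaults P))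
    found = any⁺ {xs = embedFaults P} (matches (embed u) (embed v)) (Sum.[ direct , reversed ] uv∈)

  inF-embed⁻ : ∀ P {u v} → inF (embedFaults P) (embed u) (embed v) ≡ true → (u , v) ∈ P ⊎ (v , u) ∈ P
  inF-embed⁻ P {u} {v} e with find (any⁻ (matches (embed u) (embed v)) (embedFaults P) (Equivalence.from T-≡ e))
  ... | _ , e∈ , match with ∈-map⁻ embedPair e∈
  ...   | (x , y) , xy∈P , refl with matches-sound match
  ...     | inj₁ (x≡u , y≡v) with embed-injective x≡u | embed-injective y≡v
  ...       | refl | refl = inj₁ xy∈P
  inF-embed⁻ P {u} {v} e | _ , e∈ , match | (x , y) , xy∈P , refl | inj₂ (x≡v , y≡u)
    with embed-injective x≡v | embed-injective y≡u
  ...       | refl | refl = inj₂ xy∈P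

module Faults (k₁ h q₀ : ℕ) (a b : Fin (Build.q k₁ h q₀) → Vec (Fin (suc (suc k₁))) h) where

  open import Data.Nat.Properties using (≤-trans; ≤-reflexive; +-mono-≤)
  open import Data.Nat.Tactic.RingSolver using (solve-∀)
  open import Data.Bool using (Bool; true; false)
  open import Data.List using (List; []; _∷_; _++_; map; concatMap; length; allFin)
  open import Data.List.Properties using (length-++; length-map; length-tabulate)
  open import Data.List.Membership.Propositional using (_∈_; lose)
  open import Data.List.Membership.Propositional.Properties
    using (∈-++⁺ˡ; ∈-++⁺ʳ; ∈-++⁻; ∈-map⁺; ∈-map⁻; ∈-allFin; ∈-concatMap⁺; ∈-concatMap⁻)
  open import Data.List.Relation.Unary.Any using (satisfied)
  open import Data.Product using (proj₁; proj₂)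
  open import Data.Sum using (inj₁; inj₂)
  open import Relation.Binary.PropositionalEquality
  open Gadget (suc k₁)
  open Build k₁ h q₀

  tree : Fin q → Bool → Vec (Fin k) h
  tree c false = a c
  tree c true = b c

  inCopy : Fin q → Bool → Node h × Node h → V × V
  inCopy c σ (u , v) = (c , σ , u) , (c , σ , v)

  copyFaults : Fin q → List (V × V)
  copyFaults c = map (inCopy c false) (faults (a c)) ++ map (inCopy c true) (faults (b c))

  faultEdges : List (V × V)
  faultEdges = concatMap copyFaults (allFin q)

  copyFaults-complete : ∀ c σ {u v} → Fault (tree c σ) u v → inCopy c σ (u , v) ∈ copyFaults c
  copyFaults-complete c false f = ∈-++⁺ˡ (∈-map⁺ (inCopy c false) (faults-complete f))
  copyFaults-complete c true f = ∈-++⁺ʳ (map (inCopy c false) (faults (a c))) (∈-map⁺ (inCopy c true) (faults-complete f))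

  faultEdges-complete : ∀ c σ {u v} → Fault (tree c σ) u v → inCopy c σ (u , v) ∈ faultEdges
  faultEdges-complete c σ f = ∈-concatMap⁺ copyFaults {xs = allFin q} (lose (∈-allFin c) (copyFaults-complete c σ f))

  data FaultShape : V × V → Set where
    fault : ∀ c σ u v → Fault (tree c σ) u v → FaultShape (inCopy c σ (u , v))

  copyFaults-shape : ∀ c {p} → p ∈ copyFaults c → FaultShape p
  copyFaults-shape c m with ∈-++⁻ (map (inCopy c false) (faults (a c))) m
  ... | inj₁ m-X with ∈-map⁻ (inCopy c false) m-X
  ...   | (u , v) , uv∈ , refl = fault c false u v (faults-sound (a c) uv∈)
  copyFaults-shape c m | inj₂ m-Y with ∈-map⁻ (inCopy c true) m-Y
  ...   | (u , v) , uv∈ , refl = fault c true u v (faults-sound (b c) uv∈)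

  faultEdges-shape : ∀ {p} → p ∈ faultEdges → FaultShape p
  faultEdges-shape m = let c , m-c = satisfied (∈-concatMap⁻ copyFaults {xs = allFin q} m) in copyFaults-shape c m-c

  FaultShape⇒Edge : ∀ {p} → FaultShape p → Edge (proj₁ p) (proj₂ p)
  FaultShape⇒Edge (fault c σ u v f) = inj₁ (refl , refl , inj₁ (Fault⇒Arc f))

  FaultShape⇒Fault : ∀ {c c' σ σ' u v} → FaultShape ((c , σ , u) , (c' , σ' , v)) → Fault (tree c σ) u v
  FaultShape⇒Fault (fault _ _ _ _ f) = f

  FaultShape-side : ∀ {c c' σ σ' u v} → FaultShape ((c , σ , u) , (c' , σ' , v)) → σ ≡ σ'
  FaultShape-side (fault _ _ _ _ _) = refl

  length-concatMap-≤ : ∀ {A B : Set} (f : A → List B) {m} → (∀ x → length (f x) ≤ m) →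
                       ∀ xs → length (concatMap f xs) ≤ length xs * m
  length-concatMap-≤ f bound [] = z≤n
  length-concatMap-≤ f bound (x ∷ xs) =
    ≤-trans (≤-reflexive (length-++ (f x))) (+-mono-≤ (bound x) (length-concatMap-≤ f bound xs))

  copyFaults-length : ∀ c → length (copyFaults c) ≤ h + h
  copyFaults-length c = ≤-trans (≤-reflexive (length-++ (map (inCopy c false) (faults (a c)))))
    (+-mono-≤ (≤-trans (≤-reflexive (length-map (inCopy c false) (faults (a c)))) (faults-length (a c)))
              (≤-trans (≤-reflexive (length-map (inCopy c true) (faults (b c)))) (faults-length (b c))))

  faultEdges-length : length faultEdges ≤ 2 * h * q
  faultEdges-length = ≤-trans (length-concatMap-≤ copyFaults copyFaults-length (allFin q))
    (≤-reflexive (trans (cong (_* (h + h)) (length-tabulate {n = q} (λ c → c))) (count q h)))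
    where
    count : ∀ q h → q * (h + h) ≡ 2 * h * q
    count = solve-∀

module Potential (k₁ h q₀ : ℕ) (a b : Fin (Build.q k₁ h q₀) → Vec (Fin (suc (suc k₁))) h) where

  open import Data.Nat using (_<?_)
  open import Data.Nat.Properties
  open import Data.Nat.Tactic.RingSolver using (solve-∀)
  open import Data.Fin using (zero; toℕ; fromℕ<)
  open import Data.Fin.Properties using (toℕ-fromℕ<; fromℕ<-toℕ; toℕ<n)
  open import Data.Bool using (Bool; true; false)
  open import Data.List.Membership.Propositional using (_∉_)
  open import Data.Product using (proj₁; proj₂)
  open import Data.Sum using (inj₁; inj₂)
  open import Function using (_∘_)
  open import Relation.Nullary using (yes; no; contradiction)
  open import Relation.Binary.PropositionalEquality
  open Walks
  open Gadget (suc k₁)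
  open Build k₁ h q₀
  open Faults k₁ h q₀ a b

  D : Fin q → Bool → ℕ
  D c σ = depth (leaf (tree c σ))

  A : Fin q → Bool → Node h → ℕ
  A c σ = capped (tree c σ) (D c σ + 2)

  span : Fin q → ℕ
  span c = D c false + D c true + 3

  spanᴺ : ℕ → ℕ
  spanᴺ m with m <? q
  ... | yes p = span (fromℕ< p)
  ... | no _ = 0

  spanᴺ-toℕ : ∀ c → spanᴺ (toℕ c) ≡ span c
  spanᴺ-toℕ c with toℕ c <? q
  ... | yes p = cong span (fromℕ<-toℕ c p)
  ... | no ¬p = contradiction (toℕ<n c) ¬p

  offset : ℕ → ℕ
  offset zero = 0
  offset (suc m) = offset m + spanᴺ m + 1

  local : Fin q → Bool → Node h → ℕ
  local c false v = A c false v
  local c true v = span c ∸ A c true v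

  -- X_c is measured from its root, Y_c backwards from its root.  Along every edge that
  -- survives the faults Φ grows by at most 1, except along a selected leaf pair where it
  -- jumps by 3: this is the additive loss of 2 per copy.
  Φ : V → ℕ
  Φ (c , σ , v) = offset (toℕ c) + local c σ v

  Selected : V → V → Set
  Selected x y = Σ (Fin q) λ c → (x ≡ (c , false , leaf (a c))) × (y ≡ (c , true , leaf (b c)))

  ∸-suc-≤ : ∀ m n → m ∸ n ≤ suc (m ∸ suc n)
  ∸-suc-≤ zero zero = z≤n
  ∸-suc-≤ zero (suc n) = z≤n
  ∸-suc-≤ (suc m) zero = ≤-refl
  ∸-suc-≤ (suc m) (suc n) = ∸-suc-≤ m n

  ∸-lipschitz : ∀ m {x y} → x ≤ suc y → m ∸ y ≤ suc (m ∸ x)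
  ∸-lipschitz m {zero} {y} _ = ≤-trans (m∸n≤m m y) (n≤1+n m)
  ∸-lipschitz m {suc x} (s≤s x≤y) = ≤-trans (∸-monoʳ-≤ m x≤y) (∸-suc-≤ m x)

  span∸D-true : ∀ c → span c ∸ D c true ≡ D c false + 3
  span∸D-true c = trans (cong (_∸ D c true) (regroup (D c false) (D c true))) (m+n∸n≡m (D c false + 3) (D c true))
    where regroup : ∀ x y → x + y + 3 ≡ x + 3 + y
          regroup = solve-∀

  span∸[D-true+2] : ∀ c → span c ∸ (D c true + 2) ≡ D c false + 1
  span∸[D-true+2] c = trans (cong (_∸ (D c true + 2)) (regroup (D c false) (D c true))) (m+n∸n≡m (D c false + 1) (D c true + 2))
    where regroup : ∀ x y → x + y + 3 ≡ x + 1 + (y + 2)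
          regroup = solve-∀

  offset-step : ∀ (c : Fin q) {x y} → x ≤ suc y → offset (toℕ c) + x ≤ suc (offset (toℕ c) + y)
  offset-step c {x} {y} x≤ = ≤-trans (+-monoʳ-≤ (offset (toℕ c)) x≤) (≤-reflexive (+-suc (offset (toℕ c)) y))

  local-arc : ∀ c σ {u v} → Arc u v → ¬ Fault (tree c σ) u v →
              (local c σ v ≤ suc (local c σ u)) × (local c σ u ≤ suc (local c σ v))
  local-arc c σ uv ¬f with capped-step (tree c σ) (D c σ + 2) (reachable-arc (tree c σ) uv ¬f) (depth-arc uv)
  local-arc c false uv ¬f | forward , backward = forward , backward
  local-arc c true uv ¬f | forward , backward = ∸-lipschitz (span c) backward , ∸-lipschitz (span c) forward

  local-cross : ∀ c {u v} → isLeaf u ≡ true → isLeaf v ≡ true → ¬ (u ≡ leaf (a c) × v ≡ leaf (b c)) →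
                local c true v ≤ suc (local c false u)
  local-cross c {u} {v} u-leaf v-leaf ¬selected with v ≟ᴺ leaf (b c)
  ... | yes refl = begin
    span c ∸ A c true (leaf (b c))  ≡⟨ cong (span c ∸_) (capped-leaf-selected (b c)) ⟩
    span c ∸ D c true               ≡⟨ span∸D-true c ⟩
    D c false + 3                   ≡⟨ +-suc (D c false) 2 ⟩
    suc (D c false + 2)             ≡⟨ cong suc (sym (capped-leaf-other (a c) u-leaf (λ u≡ → ¬selected (u≡ , refl)))) ⟩
    suc (A c false u)               ∎
    where open ≤-Reasoning
  ... | no v≢leaf = begin
    span c ∸ A c true v             ≡⟨ cong (span c ∸_) (capped-leaf-other (b c) v-leaf v≢leaf) ⟩
    span c ∸ (D c true + 2)         ≡⟨ span∸[D-true+2] c ⟩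
    D c false + 1                   ≡⟨ +-comm (D c false) 1 ⟩
    suc (D c false)                 ≤⟨ s≤s (capped-leaf-≥ (a c) u-leaf) ⟩
    suc (A c false u)               ∎
    where open ≤-Reasoning

  local-cross-back : ∀ c u v → local c false v ≤ suc (local c true u)
  local-cross-back c u v = begin
    A c false v                     ≤⟨ capped-≤ (a c) (D c false + 2) v ⟩
    D c false + 2                   ≡⟨ +-suc (D c false) 1 ⟩
    suc (D c false + 1)             ≡⟨ cong suc (sym (span∸[D-true+2] c)) ⟩
    suc (span c ∸ (D c true + 2))   ≤⟨ s≤s (∸-monoʳ-≤ (span c) (capped-≤ (b c) (D c true + 2) u)) ⟩
    suc (span c ∸ A c true u)       ∎
    where open ≤-Reasoning

  Φ-link : ∀ x y → Link x y → Φ y ≡ suc (Φ x)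
  Φ-link (c , _ , _) (c' , _ , _) (c'≡c+1 , refl , refl , refl , refl) = begin
    offset (toℕ c') + A c' false root          ≡⟨ cong₂ _+_ (cong offset c'≡c+1) (capped-root (a c') (D c' false + 2)) ⟩
    offset (toℕ c) + spanᴺ (toℕ c) + 1 + 0     ≡⟨ cong (λ s → offset (toℕ c) + s + 1 + 0) (spanᴺ-toℕ c) ⟩
    offset (toℕ c) + span c + 1 + 0            ≡⟨ tidy (offset (toℕ c)) (span c) ⟩
    suc (offset (toℕ c) + span c)              ≡⟨ cong (λ z → suc (offset (toℕ c) + (span c ∸ z))) (sym (capped-root (b c) (D c true + 2))) ⟩
    suc (offset (toℕ c) + (span c ∸ A c true root)) ∎
    where open ≡-Reasoning
          tidy : ∀ o s → o + s + 1 + 0 ≡ suc (o + s)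
          tidy = solve-∀

  Φ-lipschitz : ∀ x y → Edge x y → (x , y) ∉ faultEdges → (y , x) ∉ faultEdges → ¬ Selected x y → Φ y ≤ suc (Φ x)
  Φ-lipschitz (c , σ , u) (_ , _ , v) (inj₁ (refl , refl , inj₁ uv)) xy∉ _ _ =
    offset-step c (proj₁ (local-arc c σ uv (xy∉ ∘ faultEdges-complete c σ)))
  Φ-lipschitz (c , σ , u) (_ , _ , v) (inj₁ (refl , refl , inj₂ vu)) _ yx∉ _ =
    offset-step c (proj₂ (local-arc c σ vu (yx∉ ∘ faultEdges-complete c σ)))
  Φ-lipschitz (c , false , u) (_ , false , v) (inj₂ (inj₁ (refl , σ≢σ , _))) _ _ _ = contradiction refl σ≢σ
  Φ-lipschitz (c , true , u) (_ , true , v) (inj₂ (inj₁ (refl , σ≢σ , _))) _ _ _ = contradiction refl σ≢σ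
  Φ-lipschitz (c , false , u) (_ , true , v) (inj₂ (inj₁ (refl , _ , u-leaf , v-leaf))) _ _ ¬selected =
    offset-step c (local-cross c u-leaf v-leaf λ { (refl , refl) → ¬selected (c , refl , refl) })
  Φ-lipschitz (c , true , u) (_ , false , v) (inj₂ (inj₁ (refl , _ , _))) _ _ _ = offset-step c (local-cross-back c u v)
  Φ-lipschitz x y (inj₂ (inj₂ (inj₁ xy))) _ _ _ = ≤-reflexive (Φ-link x y xy)
  Φ-lipschitz x y (inj₂ (inj₂ (inj₂ yx))) _ _ _ = ≤-trans (m≤n+m (Φ y) 2) (≤-reflexive (cong suc (sym (Φ-link y x yx))))

  Live : V → V → Set
  Live x y = Edge x y × (x , y) ∉ faultEdges × (y , x) ∉ faultEdges

  Live-sym : ∀ {x y} → Live x y → Live y x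
  Live-sym {x} {y} (xy , xy∉ , yx∉) = Edge-sym x y xy , yx∉ , xy∉

  tree-live : ∀ c σ {u v} → LiveArc (tree c σ) u v → Live (c , σ , u) (c , σ , v)
  tree-live c σ (uv , ¬f) =
    inj₁ (refl , refl , inj₁ uv) , ¬f ∘ FaultShape⇒Fault ∘ faultEdges-shape ,
    arc-asym uv ∘ Fault⇒Arc ∘ FaultShape⇒Fault ∘ faultEdges-shape

  copyWalk : ∀ c → RWalk Live (c , false , root) (c , true , root) (D c false + suc (D c true))
  copyWalk c = mapᵂ (λ v → (c , false , v)) (tree-live c false) (walk-to-leaf (a c)) ++ᵂ
               step selected-live (reverseᵂ Live-sym (mapᵂ (λ v → (c , true , v)) (tree-live c true) (walk-to-leaf (b c))))
    where
    selected-live : Live (c , false , leaf (a c)) (c , true , leaf (b c))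
    selected-live = inj₂ (inj₁ (refl , (λ ()) , isLeaf-leaf (a c) , isLeaf-leaf (b c))) ,
                    (λ ()) ∘ FaultShape-side ∘ faultEdges-shape , (λ ()) ∘ FaultShape-side ∘ faultEdges-shape

  link-live : ∀ c c' → toℕ c' ≡ suc (toℕ c) → Live (c , true , root) (c' , false , root)
  link-live c c' c'≡c+1 = inj₂ (inj₂ (inj₁ (c'≡c+1 , refl , refl , refl , refl))) ,
                          (λ ()) ∘ FaultShape-side ∘ faultEdges-shape , (λ ()) ∘ FaultShape-side ∘ faultEdges-shape

  chainWalk : ∀ m (p : m < q) → Σ ℕ λ L → RWalk Live source (fromℕ< p , true , root) L × (L + 2 * suc m ≡ offset m + span (fromℕ< p))
  chainWalk zero p = D zero false + suc (D zero true) , copyWalk zero , first-copy (D zero false) (D zero true)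
    where first-copy : ∀ x y → x + suc y + 2 * 1 ≡ 0 + (x + y + 3)
          first-copy = solve-∀
  chainWalk (suc m) p with chainWalk m (<-trans (n<1+n m) p)
  ... | L , W , L≡ = L + suc (D c' false + suc (D c' true)) , (W ++ᵂ step (link-live c c' c'≡c+1) (copyWalk c')) , (begin
      L + suc (x + suc y) + 2 * suc (suc m)       ≡⟨ regroup L m x y ⟩
      (L + 2 * suc m) + 1 + (x + y + 3)           ≡⟨ cong (λ z → z + 1 + (x + y + 3)) L≡ ⟩
      offset m + span c + 1 + (x + y + 3)         ≡⟨ cong (λ s → offset m + s + 1 + (x + y + 3)) (sym spanᴺ-m) ⟩
      offset m + spanᴺ m + 1 + (x + y + 3)        ∎)
    where
    open ≡-Reasoning
    m<q = <-trans (n<1+n m) p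
    c c' : Fin q
    c = fromℕ< m<q
    c' = fromℕ< p
    x = D c' false
    y = D c' true
    c'≡c+1 : toℕ c' ≡ suc (toℕ c)
    c'≡c+1 = trans (toℕ-fromℕ< p) (cong suc (sym (toℕ-fromℕ< m<q)))
    spanᴺ-m : spanᴺ m ≡ span c
    spanᴺ-m = trans (cong spanᴺ (sym (toℕ-fromℕ< m<q))) (spanᴺ-toℕ c)
    regroup : ∀ L m x y → L + suc (x + suc y) + 2 * suc (suc m) ≡ (L + 2 * suc m) + 1 + (x + y + 3)
    regroup = solve-∀

  Φ-source : Φ source ≡ 0
  Φ-source = capped-root (a zero) (D zero false + 2)

  Φ-target : Φ target ≡ offset q₀ + span lastCopy
  Φ-target = trans (cong (λ z → offset (toℕ lastCopy) + (span lastCopy ∸ z)) (capped-root (b lastCopy) (D lastCopy true + 2)))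
                   (cong (λ i → offset i + span lastCopy) (toℕ-fromℕ< (n<1+n q₀)))

module SpannerBound (k₁ h q₀ n : ℕ) (vertexCount≤n : Build.vertexCount k₁ h q₀ ≤ n)
                    (a b : Fin (Build.q k₁ h q₀) → Vec (Fin (suc (suc k₁))) h) where

  open import Data.Nat.Properties
  open import Data.Bool using (true; false)
  open import Data.Maybe using (maybe)
  open import Data.List.Properties using (length-map)
  open import Data.List.Membership.Propositional using (_∈_; _∉_)
  open import Data.List.Membership.Propositional.Properties using (∈-map⁻)
  open import Data.List.Relation.Unary.All using (tabulate)
  open import Data.Product using (proj₁; proj₂)
  open import Data.Sum using (inj₁; inj₂)
  open import Relation.Nullary using (contradiction)
  open import Relation.Binary.PropositionalEquality
  open Walks
  open Gadget (suc k₁)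
  open Build k₁ h q₀
  open FinGraph enc-V Edge edge? Edge-sym Edge-irrefl n vertexCount≤n
  open Faults k₁ h q₀ a b
  open Potential k₁ h q₀ a b

  faultSet : FaultSet n
  faultSet = embedFaults faultEdges

  faultSet-valid : ValidFaults (2 * h * q) graph faultSet
  faultSet-valid = ≤-trans (≤-reflexive (length-map embedPair faultEdges)) faultEdges-length , tabulate in-graph
    where
    in-graph : ∀ {e} → e ∈ faultSet → adj graph (proj₁ e) (proj₂ e) ≡ true
    in-graph e∈ with ∈-map⁻ embedPair e∈
    ... | _ , p∈ , refl = adj-embed (FaultShape⇒Edge (faultEdges-shape p∈))

  Live⇒adjMinus : ∀ {x y} → Live x y → adjMinus graph faultSet (embed x) (embed y) ≡ true
  Live⇒adjMinus {x} {y} (xy , xy∉ , yx∉) rewrite adj-embed xy with inF faultSet (embed x) (embed y) in xy∈F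
  ... | false = refl
  ... | true with inF-embed⁻ faultEdges xy∈F
  ...   | inj₁ xy∈ = contradiction xy∈ xy∉
  ...   | inj₂ yx∈ = contradiction yx∈ yx∉

  Φᴺ : Fin n → ℕ
  Φᴺ x = maybe Φ 0 (unembed x)

  Φᴺ-embed : ∀ v → Φᴺ (embed v) ≡ Φ v
  Φᴺ-embed v = cong (maybe Φ 0) (unembed-embed v)

  Misses : Graph n → Set
  Misses H = ∀ c → adj H (embed (c , false , leaf (a c))) (embed (c , true , leaf (b c))) ≡ false

  Φᴺ-lipschitz : ∀ H → H ⊆G graph → Misses H → ∀ x y → adjMinus H faultSet x y ≡ true → Φᴺ y ≤ suc (Φᴺ x)
  Φᴺ-lipschitz H H⊆G misses x y e with adj H x y in xy∈H | inF faultSet x y in xy∈F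
  Φᴺ-lipschitz H H⊆G misses x y () | false | _
  Φᴺ-lipschitz H H⊆G misses x y () | true | true
  Φᴺ-lipschitz H H⊆G misses x y e | true | false with adj-unembed x y (H⊆G x y xy∈H)
  ... | u , v , refl , refl , uv =
    subst₂ (λ Φv Φu → Φv ≤ suc Φu) (sym (Φᴺ-embed v)) (sym (Φᴺ-embed u)) (Φ-lipschitz u v uv uv∉ vu∉ ¬selected)
    where
    uv∉ : (u , v) ∉ faultEdges
    uv∉ uv∈ = contradiction (trans (sym (inF-embed⁺ faultEdges (inj₁ uv∈))) xy∈F) λ ()
    vu∉ : (v , u) ∉ faultEdges
    vu∉ vu∈ = contradiction (trans (sym (inF-embed⁺ faultEdges (inj₂ vu∈))) xy∈F) λ ()
    ¬selected : ¬ Selected u v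
    ¬selected (c , refl , refl) = contradiction (trans (sym xy∈H) (misses c)) λ ()

  spanner-hits-selected : ∀ H → IsFTAdditivePairSpanner (2 * h * q) (2 * q ∸ 1) graph (embed source) (embed target) H →
                          ¬ Misses H
  spanner-hits-selected H (H⊆G , stretch) misses with chainWalk q₀ (n<1+n q₀)
  ... | L , W , L≡ with stretch faultSet faultSet-valid L (toWalk (adjMinus graph faultSet) embed Live⇒adjMinus W)
  ...   | ℓ , ℓ≤ , W′ = <⇒≱ (+-monoʳ-< L (n<1+n (2 * q ∸ 1))) (begin
    L + 2 * q                  ≡⟨ L≡ ⟩
    offset q₀ + span lastCopy  ≡⟨ sym Φ-target ⟩
    Φ target                   ≡⟨ sym (Φᴺ-embed target) ⟩
    Φᴺ (embed target)          ≤⟨ lipschitz⇒potential≤length (adjMinus H faultSet) Φᴺ (Φᴺ-lipschitz H H⊆G misses) W′ ⟩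
    Φᴺ (embed source) + ℓ      ≡⟨ cong (_+ ℓ) (trans (Φᴺ-embed source) Φ-source) ⟩
    ℓ                          ≤⟨ ℓ≤ ⟩
    L + (2 * q ∸ 1)            ∎)
    where open ≤-Reasoning


module Arithmetic where

  open import Data.Nat.Properties
  open import Data.Nat.Tactic.RingSolver using (solve-∀)
  open import Relation.Nullary using (yes; no; contradiction)
  open import Relation.Binary.PropositionalEquality

  ∸-suc : ∀ m x → suc m ≤ x → x ∸ m ≡ suc (x ∸ suc m)
  ∸-suc zero (suc x) _ = refl
  ∸-suc (suc m) (suc x) (s≤s m<x) = ∸-suc m x m<x

  bernoulli : ∀ m x → m ≤ x → suc x ^ m * (x ∸ m) ≤ x ^ suc m
  bernoulli zero x _ = ≤-reflexive (*-comm 1 x)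
  bernoulli (suc m) x m<x = *-cancelʳ-≤ _ _ (suc s) (begin
    suc x ^ suc m * s * suc s           ≡⟨ regroup (suc x) (suc x ^ m) s ⟩
    (suc x * s) * (suc x ^ m * suc s)   ≤⟨ *-monoʳ-≤ (suc x * s) ih ⟩
    (suc x * s) * x ^ suc m             ≤⟨ *-monoˡ-≤ (x ^ suc m) [1+x]s≤x[1+s] ⟩
    (x * suc s) * x ^ suc m             ≡⟨ swap x s (x ^ suc m) ⟩
    x ^ suc (suc m) * suc s             ∎)
    where
    open ≤-Reasoning
    s = x ∸ suc m
    ih : suc x ^ m * suc s ≤ x ^ suc m
    ih = subst (λ z → suc x ^ m * z ≤ x ^ suc m) (∸-suc m x m<x) (bernoulli m x (≤-trans (n≤1+n m) m<x))
    [1+x]s≤x[1+s] : suc x * s ≤ x * suc s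
    [1+x]s≤x[1+s] = subst₂ _≤_ (sym (*-suc-left x s)) (sym (*-suc x s)) (+-monoˡ-≤ (x * s) (m∸n≤m x (suc m)))
      where *-suc-left : ∀ x s → suc x * s ≡ s + x * s
            *-suc-left = solve-∀
    regroup : ∀ a b s → a * b * s * suc s ≡ (a * s) * (b * suc s)
    regroup = solve-∀
    swap : ∀ x s p → (x * suc s) * p ≡ (x * p) * suc s
    swap = solve-∀

  suc^≤2*^ : ∀ m x → 2 * m ≤ x → suc x ^ m ≤ 2 * x ^ m
  suc^≤2*^ zero x _ = s≤s z≤n
  suc^≤2*^ (suc m) (suc x′) 2m≤x = *-cancelˡ-≤ x (begin
    x * suc x ^ sm                ≤⟨ *-monoˡ-≤ (suc x ^ sm) x≤2[x∸m] ⟩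
    (2 * (x ∸ sm)) * suc x ^ sm   ≡⟨ regroup (x ∸ sm) (suc x ^ sm) ⟩
    2 * (suc x ^ sm * (x ∸ sm))   ≤⟨ *-monoʳ-≤ 2 (bernoulli sm x m≤x) ⟩
    2 * (x * x ^ sm)              ≡⟨ swap x (x ^ sm) ⟩
    x * (2 * x ^ sm)              ∎)
    where
    open ≤-Reasoning
    sm = suc m
    x = suc x′
    double : ∀ a → a + a ≡ 2 * a
    double = solve-∀
    m+m≤x : sm + sm ≤ x
    m+m≤x = ≤-trans (≤-reflexive (double sm)) 2m≤x
    m≤x : sm ≤ x
    m≤x = ≤-trans (m≤n+m sm sm) m+m≤x
    x≤2[x∸m] : x ≤ 2 * (x ∸ sm)
    x≤2[x∸m] = begin
      x                    ≡⟨ sym (m+[n∸m]≡n m≤x) ⟩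
      sm + (x ∸ sm)        ≤⟨ +-monoˡ-≤ (x ∸ sm) (subst (_≤ x ∸ sm) (m+n∸n≡m sm sm) (∸-monoˡ-≤ sm m+m≤x)) ⟩
      (x ∸ sm) + (x ∸ sm)  ≡⟨ double (x ∸ sm) ⟩
      2 * (x ∸ sm)         ∎
    regroup : ∀ s p → (2 * s) * p ≡ 2 * (p * s)
    regroup = solve-∀
    swap : ∀ x p → 2 * (x * p) ≡ x * (2 * p)
    swap = solve-∀

  ^-distribʳ-* : ∀ a b n → (a * b) ^ n ≡ a ^ n * b ^ n
  ^-distribʳ-* a b zero = refl
  ^-distribʳ-* a b (suc n) = trans (cong (a * b *_) (^-distribʳ-* a b n)) (interchange a b (a ^ n) (b ^ n))
    where interchange : ∀ a b p r → a * b * (p * r) ≡ a * p * (b * r)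
          interchange = solve-∀

  m≤m^[1+n] : ∀ m n → 1 ≤ m → m ≤ m ^ suc n
  m≤m^[1+n] m n 1≤m =
    ≤-trans (≤-reflexive (sym (*-identityʳ m))) (*-monoʳ-≤ m (≤-trans (≤-reflexive (sym (^-zeroˡ n))) (^-monoˡ-≤ n 1≤m)))

  find-boundary : ∀ (P : ℕ → Set) → (∀ y → Dec (P y)) → ∀ fuel x → P x → ¬ P (fuel + x) →
                  Σ ℕ λ y → x ≤ y × P y × ¬ P (suc y)
  find-boundary P P? zero x px ¬p-end = contradiction px ¬p-end
  find-boundary P P? (suc fuel) x px ¬p-end with P? (suc x)
  ... | no ¬p-next = x , ≤-refl , px , ¬p-next
  ... | yes p-next with find-boundary P P? fuel (suc x) p-next (subst (λ z → ¬ P z) (sym (+-suc fuel x)) ¬p-end)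
  ...   | y , x<y , py , ¬p-suc-y = y , ≤-trans (n≤1+n x) x<y , py , ¬p-suc-y

  size-tradeoff : ∀ n hq h x m → n ≤ 24 * hq * x ^ suc h → x ^ h * x ^ h ≤ m →
                  n ^ (2 * h) ≤ 576 ^ (h + 1) * m ^ (h + 1) * hq ^ (2 * h)
  size-tradeoff n hq h x m n≤ x^2h≤m = begin
    n ^ (2 * h)                                 ≤⟨ ^-monoˡ-≤ (2 * h) n≤ ⟩
    (24 * hq * X) ^ (2 * h)                     ≡⟨ ^-distribʳ-* (24 * hq) X (2 * h) ⟩
    (24 * hq) ^ (2 * h) * X ^ (2 * h)           ≡⟨ cong (_* X ^ (2 * h)) (^-distribʳ-* 24 hq (2 * h)) ⟩
    24 ^ (2 * h) * hq ^ (2 * h) * X ^ (2 * h)   ≤⟨ *-mono-≤ (*-monoˡ-≤ (hq ^ (2 * h)) 24^2h≤576^[h+1]) X^2h≤m^[h+1] ⟩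
    576 ^ (h + 1) * hq ^ (2 * h) * m ^ (h + 1)  ≡⟨ swap (576 ^ (h + 1)) (hq ^ (2 * h)) (m ^ (h + 1)) ⟩
    576 ^ (h + 1) * m ^ (h + 1) * hq ^ (2 * h)  ∎
    where
    open ≤-Reasoning
    X = x ^ suc h
    swap : ∀ a b c → a * b * c ≡ a * c * b
    swap = solve-∀
    24^2h≤576^[h+1] : 24 ^ (2 * h) ≤ 576 ^ (h + 1)
    24^2h≤576^[h+1] = begin
      24 ^ (2 * h)   ≡⟨ sym (^-*-assoc 24 2 h) ⟩
      576 ^ h        ≤⟨ ^-monoʳ-≤ 576 (m≤m+n h 1) ⟩
      576 ^ (h + 1)  ∎
    exponents : ∀ h → suc h * (2 * h) ≡ (h + h) * (h + 1)
    exponents = solve-∀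
    X^2h≤m^[h+1] : X ^ (2 * h) ≤ m ^ (h + 1)
    X^2h≤m^[h+1] = begin
      X ^ (2 * h)                 ≡⟨ ^-*-assoc x (suc h) (2 * h) ⟩
      x ^ (suc h * (2 * h))       ≡⟨ cong (x ^_) (exponents h) ⟩
      x ^ ((h + h) * (h + 1))     ≡⟨ sym (^-*-assoc x (h + h) (h + 1)) ⟩
      (x ^ (h + h)) ^ (h + 1)     ≡⟨ cong (_^ (h + 1)) (^-distribˡ-+-* x h h) ⟩
      (x ^ h * x ^ h) ^ (h + 1)   ≤⟨ ^-monoˡ-≤ (h + 1) x^2h≤m ⟩
      m ^ (h + 1)                 ∎

module LeafBlocks (k₁ h q₀ n : ℕ) (vertexCount≤n : Build.vertexCount k₁ h q₀ ≤ n) where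

  open import Data.Nat.Properties
  open import Data.Fin using (zero; suc; toℕ; combine; remQuot)
  open import Data.Fin.Properties using (toℕ<n; combine-remQuot; toℕ-combine; any?; all?; ¬∀⟶∃¬)
  open import Data.Bool using (Bool; true; false)
  open import Data.Bool.Properties using (¬-not) renaming (_≟_ to _≟ᴮ_)
  open import Data.Vec using ([]; _∷_)
  open import Data.Vec.Properties using (∷-injective)
  open import Data.Product using (proj₁; proj₂)
  open import Relation.Nullary using (yes; no; contradiction)
  open import Relation.Binary.PropositionalEquality
  open Encoding
  open EdgeCount
  open Gadget (suc k₁)
  open Build k₁ h q₀
  open FinGraph enc-V Edge edge? Edge-sym Edge-irrefl n vertexCount≤n

  digits : ∀ r → Fin (k ^ r) → Vec (Fin k) r
  digits zero _ = []
  digits (suc r) x = proj₁ (remQuot {k} (k ^ r) x) ∷ digits r (proj₂ (remQuot {k} (k ^ r) x))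

  digits-injective : ∀ r {x y : Fin (k ^ r)} → digits r x ≡ digits r y → x ≡ y
  digits-injective zero {zero} {zero} _ = refl
  digits-injective (suc r) {x} {y} e with ∷-injective e
  ... | quot≡ , rem≡ = trans (sym (combine-remQuot {k} (k ^ r) x))
                             (trans (cong₂ combine quot≡ (digits-injective r rem≡)) (combine-remQuot {k} (k ^ r) y))

  K : ℕ
  K = k ^ h

  leafVertex : Fin q → Bool → Fin K → Fin n
  leafVertex c σ i = embed (c , σ , leaf (digits h i))

  leafVertex-injective : ∀ c σ {i i'} → leafVertex c σ i ≡ leafVertex c σ i' → i ≡ i'
  leafVertex-injective c σ {i} {i'} e =
    digits-injective h (leaf-injective {h} {digits h i} {digits h i'}
      (cong (λ x → proj₂ (proj₂ x)) (embed-injective {c , σ , leaf (digits h i)} {c , σ , leaf (digits h i')} e)))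

  -- enc-V lists copy c as all of X_c, then all of Y_c
  embed-X<embed-Y : ∀ c u v → toℕ (embed (c , false , u)) < toℕ (embed (c , true , v))
  embed-X<embed-Y c u v = subst₂ _<_ (sym X-position) (sym Y-position) (+-monoʳ-< (2 * N * toℕ c) within-copy)
    where
    N = size (enc-Node h)
    U = toℕ (encode (enc-Node h) u)
    W = toℕ (encode (enc-Node h) v)
    X-position : toℕ (embed (c , false , u)) ≡ 2 * N * toℕ c + (N * 0 + U)
    X-position = trans (toℕ-embed (c , false , u)) (trans (toℕ-combine c _) (cong (2 * N * toℕ c +_) (toℕ-combine {2} {N} zero (encode (enc-Node h) u))))
    Y-position : toℕ (embed (c , true , v)) ≡ 2 * N * toℕ c + (N * 1 + W)
    Y-position = trans (toℕ-embed (c , true , v)) (trans (toℕ-combine c _) (cong (2 * N * toℕ c +_) (toℕ-combine {2} {N} (suc zero) (encode (enc-Node h) v))))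
    within-copy : N * 0 + U < N * 1 + W
    within-copy = begin-strict
      N * 0 + U   ≡⟨ cong (_+ U) (*-zeroʳ N) ⟩
      U           <⟨ toℕ<n (encode (enc-Node h) u) ⟩
      N           ≡⟨ sym (*-identityʳ N) ⟩
      N * 1       ≤⟨ m≤m+n (N * 1) W ⟩
      N * 1 + W   ∎
      where open ≤-Reasoning

  CompleteBlock : Graph n → Fin q → Set
  CompleteBlock H c = ∀ i j → adj H (leafVertex c false i) (leafVertex c true j) ≡ true

  CompleteBlock⇒K²≤numEdges : ∀ H c → CompleteBlock H c → K * K ≤ numEdges H
  CompleteBlock⇒K²≤numEdges H c complete = injection⇒≤numEdges H pair pair-injective pair-edge
    where
    pair : Fin (K * K) → Fin n × Fin n
    pair z = let i , j = remQuot K z in leafVertex c false i , leafVertex c true j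
    pair-injective : ∀ {z z'} → pair z ≡ pair z' → z ≡ z'
    pair-injective {z} {z'} e = trans (sym (combine-remQuot {K} K z))
      (trans (cong₂ combine (leafVertex-injective c false (cong proj₁ e)) (leafVertex-injective c true (cong proj₂ e)))
             (combine-remQuot {K} K z'))
    pair-edge : ∀ z → (toℕ (proj₁ (pair z)) < toℕ (proj₂ (pair z))) × (adj H (proj₁ (pair z)) (proj₂ (pair z)) ≡ true)
    pair-edge z = let i , j = remQuot K z in embed-X<embed-Y c _ _ , complete i j

  spanner⇒CompleteBlock : ∀ H → IsFTAdditivePairSpanner (2 * h * q) (2 * q ∸ 1) graph (embed source) (embed target) H →
                          Σ (Fin q) (CompleteBlock H)
  spanner⇒CompleteBlock H spanner with any? (λ c → all? λ i → all? λ j → adj H (leafVertex c false i) (leafVertex c true j) ≟ᴮ true)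
  ... | yes block = block
  ... | no ¬block = contradiction misses (SpannerBound.spanner-hits-selected k₁ h q₀ n vertexCount≤n a b H spanner)
    where
    missing : ∀ c → Σ (Fin K) λ i → Σ (Fin K) λ j → adj H (leafVertex c false i) (leafVertex c true j) ≡ false
    missing c with ¬∀⟶∃¬ K _ (λ i → all? λ j → adj H (leafVertex c false i) (leafVertex c true j) ≟ᴮ true) (λ all-i → ¬block (c , all-i))
    ... | i , ¬all-j with ¬∀⟶∃¬ K _ (λ j → adj H (leafVertex c false i) (leafVertex c true j) ≟ᴮ true) ¬all-j
    ...   | j , ¬edge = i , j , ¬-not ¬edge
    a b : Fin q → Vec (Fin k) h
    a c = digits h (proj₁ (missing c))
    b c = digits h (proj₁ (proj₂ (missing c)))
    misses : SpannerBound.Misses k₁ h q₀ n vertexCount≤n a b H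
    misses c = proj₂ (proj₂ (missing c))

module Construction (q₀ h₀ : ℕ) where

  open import Data.Nat using (_≤?_)
  open import Data.Nat.Properties
  open import Data.Nat.Tactic.RingSolver using (solve-∀)
  open import Relation.Binary.PropositionalEquality
  open Arithmetic

  q h : ℕ
  q = suc q₀
  h = suc h₀

  SpannerLowerBound : (n : ℕ) → Graph n → Fin n → Fin n → Set
  SpannerLowerBound n G s t = (H : Graph n) → IsFTAdditivePairSpanner (2 * h * q) (2 * q ∸ 1) G s t H →
                              n ^ (2 * h) ≤ 576 ^ (h + 1) * numEdges H ^ (h + 1) * (h * q) ^ (2 * h)

  vertexCount-bound : ∀ k₁ → Build.vertexCount k₁ h q₀ ≤ 12 * q * h * suc (suc k₁) ^ suc h
  vertexCount-bound k₁ = begin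
    q * (2 * Bounds.nodeCount k₁ h)           ≤⟨ *-monoʳ-≤ q (*-monoʳ-≤ 2 (Bounds.nodeCount-bound k₁ h)) ⟩
    q * (2 * (5 * h * X + 1))                ≡⟨ expand q h X ⟩
    10 * (q * (h * X)) + 2 * q               ≤⟨ +-monoʳ-≤ (10 * (q * (h * X))) (*-monoʳ-≤ 2 q≤qhX) ⟩
    10 * (q * (h * X)) + 2 * (q * (h * X))   ≡⟨ collect q h X ⟩
    12 * q * h * X                           ∎
    where
    open ≤-Reasoning
    X = suc (suc k₁) ^ suc h
    expand : ∀ q h X → q * (2 * (5 * h * X + 1)) ≡ 10 * (q * (h * X)) + 2 * q
    expand = solve-∀
    collect : ∀ q h X → 10 * (q * (h * X)) + 2 * (q * (h * X)) ≡ 12 * q * h * X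
    collect = solve-∀
    q≤qhX : q ≤ q * (h * X)
    q≤qhX = ≤-trans (≤-reflexive (sym (*-identityʳ q))) (*-monoʳ-≤ q (*-mono-≤ {1} {h} {1} {X} (s≤s z≤n) (m^n>0 (suc (suc k₁)) (suc h))))

  graph-at-scale : ∀ n k₁ → 12 * q * h * suc (suc k₁) ^ suc h ≤ n → n ≤ 24 * (h * q) * suc (suc k₁) ^ suc h →
                   Σ (Graph n) λ G → Σ (Fin n) λ s → Σ (Fin n) λ t → SpannerLowerBound n G s t
  graph-at-scale n k₁ fits n≤ = graph , embed source , embed target , λ H spanner →
      size-tradeoff n (h * q) h (suc (suc k₁)) (numEdges H) n≤
        (let c , complete = spanner⇒CompleteBlock H spanner in CompleteBlock⇒K²≤numEdges H c complete)
    where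
    open Build k₁ h q₀ using (enc-V; Edge; edge?; Edge-sym; Edge-irrefl; source; target)
    open FinGraph enc-V Edge edge? Edge-sym Edge-irrefl n (≤-trans (vertexCount-bound k₁) fits)
    open LeafBlocks k₁ h q₀ n (≤-trans (vertexCount-bound k₁) fits)

  threshold : ℕ
  threshold = 12 * q * h * (2 * suc h) ^ suc h

  threshold-exceeded : ∀ n → ¬ (12 * q * h * (n + 2 * suc h) ^ suc h ≤ n)
  threshold-exceeded n fits = <-irrefl refl (≤-trans (m<m+n n (s≤s z≤n))
    (≤-trans (m≤m^[1+n] (n + 2 * suc h) h (≤-trans (s≤s z≤n) (m≤n+m (2 * suc h) n)))
             (≤-trans (m≤n*m ((n + 2 * suc h) ^ suc h) (12 * q * h)) fits)))

  -- The branching k is the largest x with 12 q h x^(h+1) ≤ n; then n < 24 q h x^(h+1).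
  graph-of-size : ∀ n → threshold ≤ n → Σ (Graph n) λ G → Σ (Fin n) λ s → Σ (Fin n) λ t → SpannerLowerBound n G s t
  graph-of-size n threshold≤n
    with find-boundary (λ x → 12 * q * h * x ^ suc h ≤ n) (λ x → 12 * q * h * x ^ suc h ≤? n) n (2 * suc h)
                       threshold≤n (threshold-exceeded n)
  ... | zero , () , _
  ... | suc zero , s≤s () , _
  ... | suc (suc k₁) , 2[h+1]≤x , fits , ¬fits-next = graph-at-scale n k₁ fits (begin
    n                                        ≤⟨ <⇒≤ (≰⇒> ¬fits-next) ⟩
    12 * q * h * suc x ^ suc h               ≤⟨ *-monoʳ-≤ (12 * q * h) (suc^≤2*^ (suc h) x 2[h+1]≤x) ⟩
    12 * q * h * (2 * x ^ suc h)             ≡⟨ regroup q h (x ^ suc h) ⟩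
    24 * (h * q) * x ^ suc h                 ∎)
    where
    open ≤-Reasoning
    x = suc (suc k₁)
    regroup : ∀ q h X → 12 * q * h * (2 * X) ≡ 24 * (h * q) * X
    regroup = solve-∀

theorem3 : Σ ℕ (λ d → (0 < d) × ((q h : ℕ) → 0 < q → 0 < h →
    Σ ℕ (λ N → (n : ℕ) → N ≤ n →
    Σ (Graph n) (λ G → Σ (Fin n) (λ s → Σ (Fin n) (λ t →
    (H : Graph n) → IsFTAdditivePairSpanner (2 * h * q) (2 * q ∸ 1) G s t H →
    n ^ (2 * h) ≤ d ^ (h + 1) * numEdges H ^ (h + 1) * (h * q) ^ (2 * h)))))))
theorem3 = 576 , s≤s z≤n , λ where
  zero h () _
  (suc q₀) zero _ ()
  (suc q₀) (suc h₀) _ _ → Construction.threshold q₀ h₀ , Construction.graph-of-size q₀ h₀
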